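{- Let $k\le n$. Sample $a\in\{0,1\}^n$ uniformly and $h:[n]\to[k]$ uniformly at random, and let $\mathsf{C}=C_{a,h}$. Fix any $T\subseteq\{0,1\}^n$ and let $\mu=|T|/2^n$. Then for any $\varepsilon,\eta>0$, $$\Pr_{a,h}\left[\left|\frac{|T\cap\mathsf{C}|}{2^k}-\mu\right|\ge\varepsilon\right]<\eta$$ provided $k\ge \frac{A}{\varepsilon^4\eta^2}\log\left(\frac{1}{\varepsilon\eta}\right)$, where $A>0$ is a sufficiently large absolute constant. Here $|T\cap\mathsf{C}|$ denotes the number of $y\in\{0,1\}^k$ with $x(y)\in T$.
   Context: Given $a\in\{0,1\}^n$ and $h:[n]\to[k]$, for $y\in\{0,1\}^k$ define $x(y)\in\{0,1\}^n$ by $x(y)_i=y_{h(i)}\oplus a_i$, and $C_{a,h}=\{x(y):y\in\{0,1\}^k\}$ (the subcube embedded via $a,h$).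
   Formalization: The parameters ε and η range over the positive rationals. -}

module Defs where

open import Data.Bool using (Bool; true; false; _xor_)
open import Data.Nat as ℕ using (ℕ; zero; suc)
open import Data.Integer as ℤ using (ℤ; +_; -[1+_])
open import Data.Fin using (Fin)
open import Data.Product using (_×_; _,_; proj₁; proj₂)
open import Data.List using (List; []; _∷_; allFin; map; concatMap; length; filter)
open import Data.Vec using (Vec; []; _∷_; lookup; tabulate)
open import Data.Rational using (ℚ; _/_; 0ℚ; 1ℚ; _*_; _-_; ∣_∣; _≤_; _≤?_; ↥_; ↧ₙ_)
open import Relation.Nullary using (¬_)
open import Relation.Nullary.Decidable using (¬?)

_^ℚ_ : ℚ → ℕ → ℚ
q ^ℚ zero  = 1ℚ
q ^ℚ suc m = q * (q ^ℚ m)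

-- the rational number m / d  (convention: m / 0 := 0; only used when d ≥ 1
-- except for the degenerate empty sample space n ≥ 1, k = 0)
_/ₙ_ : ℕ → ℕ → ℚ
m /ₙ zero  = 0ℚ
m /ₙ suc d = (+ m) / suc d

allVecs : {A : Set} → List A → (n : ℕ) → List (Vec A n)
allVecs xs zero    = [] ∷ []
allVecs xs (suc n) = concatMap (λ x → map (x ∷_) (allVecs xs n)) xs

bools : List Bool
bools = false ∷ true ∷ []

-- {0,1}^n as Vec Bool n; a subset T ⊆ {0,1}^n as its characteristic function
Cube : ℕ → Set
Cube n = Vec Bool n

card : {n : ℕ} → (Cube n → Bool) → ℕ
card {n} T = length (filter (λ x → T x Data.Bool.≟ true) (allVecs bools n))
  where import Data.Bool

-- x(y)_i = y_{h(i)} ⊕ a_i ;  a ∈ {0,1}^n, h : [n] → [k] (as Vec (Fin k) n)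
embed : {n k : ℕ} → Cube n → Vec (Fin k) n → Cube k → Cube n
embed a h y = tabulate (λ i → lookup y (lookup h i) xor lookup a i)

cardInCube : {n k : ℕ} → (Cube n → Bool) → Cube n → Vec (Fin k) n → ℕ
cardInCube {n} {k} T a h =
  length (filter (λ y → T (embed a h y) Data.Bool.≟ true) (allVecs bools k))
  where import Data.Bool

density : {n : ℕ} → (Cube n → Bool) → ℚ
density {n} T = card T /ₙ (2 ℕ.^ n)

samples : (n k : ℕ) → List (Cube n × Vec (Fin k) n)
samples n k = concatMap (λ a → map (a ,_) (allVecs (allFin k) n)) (allVecs bools n)

-- Pr_{a,h}[ | |T ∩ C_{a,h}|/2^k − μ | ≥ ε ]  (uniform over 2^n · k^n pairs)
prDeviates : (n k : ℕ) → (Cube n → Bool) → ℚ → ℚ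
prDeviates n k T ε =
  length (filter (λ p → ε ≤? ∣ (cardInCube T (proj₁ p) (proj₂ p) /ₙ (2 ℕ.^ k)) - density T ∣)
                 (samples n k))
  /ₙ (2 ℕ.^ n ℕ.* k ℕ.^ n)

-- Log2InvLe u t  :⇔  log₂ (1/u) ≤ t   (for u > 0),
-- i.e. (1/u) ≤ 2^t; writing t = p/q in lowest terms (q ≥ 1):
--   p ≥ 0 :  1 ≤ 2^p · u^q ;   p = −(m+1) :  2^(m+1) ≤ u^q
Log2InvLe : ℚ → ℚ → Set
Log2InvLe u t with ↥ t
... | + p      = 1ℚ ≤ (((+ 2) / 1) ^ℚ p) * (u ^ℚ (↧ₙ t))
... | -[1+ m ] = ((+ 2) / 1) ^ℚ suc m ≤ u ^ℚ (↧ₙ t)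

module Submission where

-- Write hits(a, h) = |T ∩ C_{a,h}|.  Averaging over a makes every x(y) uniform, so E[hits] = 2^k μ,
-- while E[hits²] = Σ_{y,y′} Pr[x(y), x(y′) ∈ T] depends on y, y′ only through w = y ⊕ y′: it is the
-- correlation of T with its translate by z = (w_{h(i)})_i.  In the Walsh–Fourier expansion of T,
-- averaging over h weighs level j of this correlation by (bias w / k)^j, where bias w is the number
-- of zeros minus the number of ones of w; averaging over w kills level 1 and bounds each level
-- j ≥ 2 by 1/k.  Hence Var(hits / 2^k) ≤ μ(1 − μ)/k ≤ 1/4k, and Chebyshev's inequality gives
-- Pr[|hits / 2^k − μ| ≥ ε] ≤ 1/(4kε²) < η as soon as 4kε²η > 1.  Otherwise, for η ≤ 1 (η > 1 is
-- trivial), kε⁴η² < 1 ≤ log₂(1/εη) and the hypothesis on k fails; so A = 1 works.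

open import Defs

module Sums where

  open import Data.Bool using (Bool; true; false)
  import Data.Bool as Bool
  open import Data.Integer using (ℤ; +_; 0ℤ; 1ℤ; _+_; _*_; -_; _≤_)
  import Data.Integer.Properties as ℤP
  open import Data.List using (List; []; _∷_; map; concatMap; length; filter; _++_)
  open import Relation.Nullary using (Dec; does; yes; no)
  open import Relation.Unary using (Decidable)
  open import Relation.Binary.PropositionalEquality
  open import Data.Integer.Solver using (module +-*-Solver)
  open +-*-Solver

  private variable
    A B : Set

  ∑ : List A → (A → ℤ) → ℤ
  ∑ []       f = 0ℤ
  ∑ (x ∷ xs) f = f x + ∑ xs f

  syntax ∑ xs (λ x → e) = ∑[ x ∈ xs ] e

  ∑-cong : (xs : List A) {f g : A → ℤ} → (∀ x → f x ≡ g x) → ∑ xs f ≡ ∑ xs g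
  ∑-cong []       f≗g = refl
  ∑-cong (x ∷ xs) f≗g = cong₂ _+_ (f≗g x) (∑-cong xs f≗g)

  ∑-++ : (xs ys : List A) (f : A → ℤ) → ∑ (xs ++ ys) f ≡ ∑ xs f + ∑ ys f
  ∑-++ []       ys f = sym (ℤP.+-identityˡ _)
  ∑-++ (x ∷ xs) ys f = trans (cong (λ s → f x + s) (∑-++ xs ys f)) (sym (ℤP.+-assoc (f x) _ _))

  ∑-map : (g : A → B) (xs : List A) (f : B → ℤ) → ∑ (map g xs) f ≡ ∑[ x ∈ xs ] f (g x)
  ∑-map g []       f = refl
  ∑-map g (x ∷ xs) f = cong (λ s → f (g x) + s) (∑-map g xs f)

  ∑-concatMap : (g : A → List B) (xs : List A) (f : B → ℤ) →
                ∑ (concatMap g xs) f ≡ ∑[ x ∈ xs ] ∑ (g x) f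
  ∑-concatMap g []       f = refl
  ∑-concatMap g (x ∷ xs) f =
    trans (∑-++ (g x) (concatMap g xs) f) (cong (λ s → ∑ (g x) f + s) (∑-concatMap g xs f))

  ∑-+ : (xs : List A) (f g : A → ℤ) → ∑[ x ∈ xs ] (f x + g x) ≡ ∑ xs f + ∑ xs g
  ∑-+ []       f g = refl
  ∑-+ (x ∷ xs) f g = trans (cong (λ s → f x + g x + s) (∑-+ xs f g))
    (solve 4 (λ a b c d → (a :+ b) :+ (c :+ d) := (a :+ c) :+ (b :+ d)) refl (f x) (g x) (∑ xs f) (∑ xs g))

  ∑-*ˡ : (xs : List A) (c : ℤ) (f : A → ℤ) → ∑[ x ∈ xs ] (c * f x) ≡ c * ∑ xs f
  ∑-*ˡ []       c f = sym (ℤP.*-zeroʳ c)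
  ∑-*ˡ (x ∷ xs) c f = trans (cong (λ s → c * f x + s) (∑-*ˡ xs c f)) (sym (ℤP.*-distribˡ-+ c (f x) _))

  ∑-neg : (xs : List A) (f : A → ℤ) → ∑[ x ∈ xs ] (- f x) ≡ - ∑ xs f
  ∑-neg []       f = refl
  ∑-neg (x ∷ xs) f = trans (cong (λ s → - f x + s) (∑-neg xs f)) (sym (ℤP.neg-distrib-+ (f x) _))

  ∑-zero : (xs : List A) → ∑[ _ ∈ xs ] 0ℤ ≡ 0ℤ
  ∑-zero []       = refl
  ∑-zero (x ∷ xs) = trans (ℤP.+-identityˡ _) (∑-zero xs)

  ∑-comm : (xs : List A) (ys : List B) (f : A → B → ℤ) →
           ∑[ x ∈ xs ] ∑[ y ∈ ys ] f x y ≡ ∑[ y ∈ ys ] ∑[ x ∈ xs ] f x y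
  ∑-comm []       ys f = sym (∑-zero ys)
  ∑-comm (x ∷ xs) ys f = trans (cong (λ s → ∑ ys (f x) + s) (∑-comm xs ys f)) (sym (∑-+ ys (f x) _))

  ∑-const : (xs : List A) (c : ℤ) → ∑[ _ ∈ xs ] c ≡ + length xs * c
  ∑-const []       c = sym (ℤP.*-zeroˡ c)
  ∑-const (x ∷ xs) c = trans (cong (λ s → c + s) (∑-const xs c))
    (trans (cong (λ s → s + + length xs * c) (sym (ℤP.*-identityˡ c))) (sym (ℤP.*-distribʳ-+ c 1ℤ (+ length xs))))

  ∑-mono-≤ : (xs : List A) {f g : A → ℤ} → (∀ x → f x ≤ g x) → ∑ xs f ≤ ∑ xs g
  ∑-mono-≤ []       f≤g = ℤP.≤-refl
  ∑-mono-≤ (x ∷ xs) f≤g = ℤP.+-mono-≤ (f≤g x) (∑-mono-≤ xs f≤g)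

  ∑*∑ : (xs : List A) (ys : List B) (f : A → ℤ) (g : B → ℤ) →
        ∑ xs f * ∑ ys g ≡ ∑[ x ∈ xs ] ∑[ y ∈ ys ] (f x * g y)
  ∑*∑ xs ys f g = begin
    ∑ xs f * ∑ ys g               ≡⟨ ℤP.*-comm (∑ xs f) _ ⟩
    ∑ ys g * ∑ xs f               ≡⟨ ∑-*ˡ xs (∑ ys g) f ⟨
    ∑[ x ∈ xs ] (∑ ys g * f x)    ≡⟨ ∑-cong xs (λ x → ℤP.*-comm (∑ ys g) (f x)) ⟩
    ∑[ x ∈ xs ] (f x * ∑ ys g)    ≡⟨ ∑-cong xs (λ x → ∑-*ˡ ys (f x) g) ⟨
    ∑[ x ∈ xs ] ∑[ y ∈ ys ] (f x * g y) ∎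
    where open ≡-Reasoning

  𝟙 : Bool → ℤ
  𝟙 true  = 1ℤ
  𝟙 false = 0ℤ

  𝟙-does-≟-true : (b : Bool) → 𝟙 (does (b Bool.≟ true)) ≡ 𝟙 b
  𝟙-does-≟-true true  = refl
  𝟙-does-≟-true false = refl

  length-filter≡∑ : {P : A → Set} (P? : Decidable P) (xs : List A) →
                    + length (filter P? xs) ≡ ∑[ x ∈ xs ] 𝟙 (does (P? x))
  length-filter≡∑ P? []       = refl
  length-filter≡∑ P? (x ∷ xs) with does (P? x)
  ... | true  = trans (ℤP.pos-+ 1 _) (cong (λ s → 1ℤ + s) (length-filter≡∑ P? xs))
  ... | false = trans (length-filter≡∑ P? xs) (sym (ℤP.+-identityˡ _))

  length-filter*c≤∑ : {P : A → Set} (P? : Decidable P) (xs : List A) (f : A → ℤ) (c : ℤ) →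
                      (∀ x → 0ℤ ≤ f x) → (∀ x → P x → c ≤ f x) → + length (filter P? xs) * c ≤ ∑ xs f
  length-filter*c≤∑ {P = P} P? xs f c 0≤f P⇒c≤f = begin
    + length (filter P? xs) * c           ≡⟨ cong (_* c) (length-filter≡∑ P? xs) ⟩
    ∑[ x ∈ xs ] 𝟙 (does (P? x)) * c       ≡⟨ ℤP.*-comm (∑[ x ∈ xs ] 𝟙 (does (P? x))) c ⟩
    c * ∑[ x ∈ xs ] 𝟙 (does (P? x))       ≡⟨ ∑-*ˡ xs c _ ⟨
    ∑[ x ∈ xs ] (c * 𝟙 (does (P? x)))     ≤⟨ ∑-mono-≤ xs (λ x → pointwise x (P? x)) ⟩
    ∑ xs f ∎
    where
    open ℤP.≤-Reasoning
    pointwise : ∀ x → (p : Dec (P x)) → c * 𝟙 (does p) ≤ f x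
    pointwise x (yes px) = subst (_≤ f x) (sym (ℤP.*-identityʳ c)) (P⇒c≤f x px)
    pointwise x (no _)   = subst (_≤ f x) (sym (ℤP.*-zeroʳ c)) (0≤f x)

module IntegerLemmas where

  open import Data.Nat as ℕ using (ℕ; zero; suc)
  import Data.Nat.Properties as ℕP
  open import Data.Integer as ℤ using (ℤ; +_; -[1+_]; 0ℤ; _+_; _*_; -_; _-_; _^_; _≤_; _<_; +≤+; +<+; -≤+; ∣_∣)
  import Data.Integer.Properties as ℤP
  open import Relation.Binary.PropositionalEquality
  open import Data.Integer.Solver using (module +-*-Solver)
  open +-*-Solver

  pos-^ : (m n : ℕ) → + (m ℕ.^ n) ≡ (+ m) ^ n
  pos-^ m zero    = refl
  pos-^ m (suc n) = trans (ℤP.pos-* m (m ℕ.^ n)) (cong (λ s → + m * s) (pos-^ m n))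

  0≤i*i : (i : ℤ) → 0ℤ ≤ i * i
  0≤i*i (+ n)    = subst (0ℤ ≤_) (ℤP.pos-* n n) (+≤+ ℕ.z≤n)
  0≤i*i -[1+ n ] = +≤+ ℕ.z≤n

  0≤i*j : {i j : ℤ} → 0ℤ ≤ i → 0ℤ ≤ j → 0ℤ ≤ i * j
  0≤i*j {i} 0≤i 0≤j = subst (_≤ i * _) (ℤP.*-zeroʳ i) (ℤP.*-monoˡ-≤-nonNeg i {{ℤ.nonNegative 0≤i}} 0≤j)

  0≤i^n : {i : ℤ} (n : ℕ) → 0ℤ ≤ i → 0ℤ ≤ i ^ n
  0≤i^n zero    0≤i = +≤+ ℕ.z≤n
  0≤i^n (suc n) 0≤i = 0≤i*j 0≤i (0≤i^n n 0≤i)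

  0<i*j : {i j : ℤ} → 0ℤ ℤ.< i → 0ℤ ℤ.< j → 0ℤ ℤ.< i * j
  0<i*j {i} 0<i 0<j = subst (ℤ._< i * _) (ℤP.*-zeroʳ i) (ℤP.*-monoˡ-<-pos i {{ℤ.positive 0<i}} 0<j)

  0<2^n : (n : ℕ) → 0ℤ ℤ.< (+ 2) ^ n
  0<2^n n = subst (0ℤ ℤ.<_) (pos-^ 2 n) (ℤ.+<+ (ℕP.m^n>0 2 n))

  i≤∣i∣ : (i : ℤ) → i ≤ + ∣ i ∣
  i≤∣i∣ (+ n)    = ℤP.≤-refl
  i≤∣i∣ -[1+ n ] = -≤+

  ∣i+j∣≤ : {i j x y : ℤ} → + ∣ i ∣ ≤ x → + ∣ j ∣ ≤ y → + ∣ i + j ∣ ≤ x + y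
  ∣i+j∣≤ {i} {j} {x} {y} ∣i∣≤x ∣j∣≤y = ℤP.≤-trans (+≤+ (ℤP.∣i+j∣≤∣i∣+∣j∣ i j))
    (subst (_≤ x + y) (sym (ℤP.pos-+ ∣ i ∣ ∣ j ∣)) (ℤP.+-mono-≤ ∣i∣≤x ∣j∣≤y))

  ∣i*j∣≤ : {i j x y : ℤ} → + ∣ i ∣ ≤ x → + ∣ j ∣ ≤ y → + ∣ i * j ∣ ≤ x * y
  ∣i*j∣≤ {i} {j} {x} {y} ∣i∣≤x ∣j∣≤y rewrite ℤP.abs-* i j | ℤP.pos-* ∣ i ∣ ∣ j ∣ =
    ℤP.≤-trans (ℤP.*-monoʳ-≤-nonNeg (+ ∣ j ∣) ∣i∣≤x)
               (ℤP.*-monoˡ-≤-nonNeg x {{ℤ.nonNegative (ℤP.≤-trans (+≤+ ℕ.z≤n) ∣i∣≤x)}} ∣j∣≤y)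

  +∣i∣*+∣i∣≡i*i : (i : ℤ) → + ∣ i ∣ * + ∣ i ∣ ≡ i * i
  +∣i∣*+∣i∣≡i*i (+ n)    = refl
  +∣i∣*+∣i∣≡i*i -[1+ n ] = refl

  *-self-mono-≤ : {i j : ℤ} → 0ℤ ≤ i → i ≤ j → i * i ≤ j * j
  *-self-mono-≤ {i} {j} 0≤i i≤j = ℤP.≤-trans (ℤP.*-monoˡ-≤-nonNeg i {{ℤ.nonNegative 0≤i}} i≤j)
                                             (ℤP.*-monoʳ-≤-nonNeg j {{ℤ.nonNegative (ℤP.≤-trans 0≤i i≤j)}} i≤j)

  4*τ*[P-τ]≤P² : (P τ : ℤ) → + 4 * (P * τ - τ * τ) ≤ P * P
  4*τ*[P-τ]≤P² P τ = subst (+ 4 * (P * τ - τ * τ) ≤_)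
    (solve 2 (λ P τ → con (+ 4) :* (P :* τ :- τ :* τ) :+ (P :- con (+ 2) :* τ) :* (P :- con (+ 2) :* τ) := P :* P) refl P τ)
    (ℤP.≤-trans (ℤP.≤-reflexive (sym (ℤP.+-identityʳ _)))
                (ℤP.+-monoʳ-≤ (+ 4 * (P * τ - τ * τ)) (0≤i*i (P - + 2 * τ))))

  b*f<g*N⇐c*b≤x*N : {c x b N f g : ℤ} → 0ℤ ≤ c → 0ℤ ≤ f → 0ℤ < N →
                    c * b ≤ x * N → x * f < c * g → b * f < g * N
  b*f<g*N⇐c*b≤x*N {c} {x} {b} {N} {f} {g} 0≤c 0≤f 0<N cb≤xN xf<cg =
    ℤP.*-cancelˡ-<-nonNeg c {{ℤ.nonNegative 0≤c}} (begin-strict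
      c * (b * f)      ≡⟨ ℤP.*-assoc c b f ⟨
      c * b * f        ≤⟨ ℤP.*-monoʳ-≤-nonNeg f {{ℤ.nonNegative 0≤f}} cb≤xN ⟩
      x * N * f        ≡⟨ solve 3 (λ x N f → x :* N :* f := x :* f :* N) refl x N f ⟩
      x * f * N        <⟨ ℤP.*-monoʳ-<-pos N {{ℤ.positive 0<N}} xf<cg ⟩
      c * g * N        ≡⟨ ℤP.*-assoc c g N ⟩
      c * (g * N)      ∎)
    where open ℤP.≤-Reasoning

  b*f<g*N⇐b≤N : {b N f g : ℤ} → 0ℤ ≤ f → 0ℤ < N → b ≤ N → f < g → b * f < g * N
  b*f<g*N⇐b≤N {b} {N} {f} {g} 0≤f 0<N b≤N f<g = begin-strict
    b * f     ≤⟨ ℤP.*-monoʳ-≤-nonNeg f {{ℤ.nonNegative 0≤f}} b≤N ⟩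
    N * f     <⟨ ℤP.*-monoˡ-<-pos N {{ℤ.positive 0<N}} f<g ⟩
    N * g     ≡⟨ ℤP.*-comm N g ⟩
    g * N     ∎
    where open ℤP.≤-Reasoning

module BooleanCube where

  open import Data.Bool using (Bool; true; false; not; _xor_)
  open import Data.Bool.Properties using (xor-comm)
  open import Data.Nat as ℕ using (ℕ; zero; suc)
  open import Data.Integer using (ℤ; +_; _+_; _*_; _^_)
  import Data.Integer.Properties as ℤP
  open import Data.Fin using (Fin)
  open import Data.List using (List; []; _∷_; map; concatMap; length)
  import Data.List.Properties as List
  open import Data.Vec using (Vec; []; _∷_; zipWith; lookup)
  import Data.Vec as Vec
  open import Data.Vec.Properties using (zipWith-comm; lookup-zipWith)
  open import Relation.Binary.PropositionalEquality
  open Sums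
  open IntegerLemmas using (pos-^)

  private variable
    A B : Set
    n k : ℕ

  cube : (n : ℕ) → List (Cube n)
  cube = allVecs bools

  length-allVecs : (xs : List A) (n : ℕ) → length (allVecs xs n) ≡ length xs ℕ.^ n
  length-allVecs xs zero    = refl
  length-allVecs xs (suc n) = go xs
    where
    go : (ys : List _) → length (concatMap (λ x → map (x ∷_) (allVecs xs n)) ys) ≡ length ys ℕ.* (length xs ℕ.^ n)
    go []       = refl
    go (y ∷ ys) = trans (List.length-++ (map (y ∷_) (allVecs xs n)))
      (cong₂ ℕ._+_ (trans (List.length-map (y ∷_) (allVecs xs n)) (length-allVecs xs n)) (go ys))

  ∑-cube-const : (n : ℕ) (c : ℤ) → ∑[ _ ∈ cube n ] c ≡ (+ 2) ^ n * c
  ∑-cube-const n c = trans (∑-const (cube n) c)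
    (cong (_* c) (trans (cong +_ (length-allVecs bools n)) (pos-^ 2 n)))

  ∑-cube-suc : (n : ℕ) (f : Cube (suc n) → ℤ) →
               ∑ (cube (suc n)) f ≡ ∑[ a ∈ cube n ] f (false ∷ a) + ∑[ a ∈ cube n ] f (true ∷ a)
  ∑-cube-suc n f = trans (∑-concatMap (λ x → map (x ∷_) (cube n)) bools f)
    (cong₂ _+_ (∑-map (false ∷_) (cube n) f)
               (trans (ℤP.+-identityʳ _) (∑-map (true ∷_) (cube n) f)))

  _⊕_ : Vec Bool n → Vec Bool n → Vec Bool n
  _⊕_ = zipWith _xor_

  ⊕-comm : (u v : Vec Bool n) → u ⊕ v ≡ v ⊕ u
  ⊕-comm = zipWith-comm xor-comm

  ⊕-telescope : (a u v : Vec Bool n) → (a ⊕ u) ⊕ (u ⊕ v) ≡ a ⊕ v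
  ⊕-telescope []       []       []       = refl
  ⊕-telescope (a ∷ as) (u ∷ us) (v ∷ vs) = cong₂ _∷_ (bit a u v) (⊕-telescope as us vs)
    where
    bit : (a u v : Bool) → (a xor u) xor (u xor v) ≡ a xor v
    bit false false v     = refl
    bit false true  false = refl
    bit false true  true  = refl
    bit true  false v     = refl
    bit true  true  false = refl
    bit true  true  true  = refl

  ∑-cube-⊕ : (n : ℕ) (c : Cube n) (f : Cube n → ℤ) → ∑[ a ∈ cube n ] f (a ⊕ c) ≡ ∑ (cube n) f
  ∑-cube-⊕ zero    []      f = refl
  ∑-cube-⊕ (suc n) (b ∷ c) f = begin
    ∑[ a ∈ cube (suc n) ] f (a ⊕ (b ∷ c))
      ≡⟨ ∑-cube-suc n _ ⟩
    ∑[ a ∈ cube n ] f (b ∷ (a ⊕ c)) + ∑[ a ∈ cube n ] f (not b ∷ (a ⊕ c))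
      ≡⟨ cong₂ _+_ (∑-cube-⊕ n c (λ a → f (b ∷ a))) (∑-cube-⊕ n c (λ a → f (not b ∷ a))) ⟩
    ∑[ a ∈ cube n ] f (b ∷ a) + ∑[ a ∈ cube n ] f (not b ∷ a)
      ≡⟨ swap-halves b ⟩
    ∑[ a ∈ cube n ] f (false ∷ a) + ∑[ a ∈ cube n ] f (true ∷ a)
      ≡⟨ ∑-cube-suc n f ⟨
    ∑ (cube (suc n)) f ∎
    where
    open ≡-Reasoning
    swap-halves : (b : Bool) → ∑[ a ∈ cube n ] f (b ∷ a) + ∑[ a ∈ cube n ] f (not b ∷ a)
                             ≡ ∑[ a ∈ cube n ] f (false ∷ a) + ∑[ a ∈ cube n ] f (true ∷ a)
    swap-halves false = refl
    swap-halves true  = ℤP.+-comm (∑[ a ∈ cube n ] f (true ∷ a)) _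

  ∑-cube-⊕ˡ : (n : ℕ) (c : Cube n) (f : Cube n → ℤ) → ∑[ a ∈ cube n ] f (c ⊕ a) ≡ ∑ (cube n) f
  ∑-cube-⊕ˡ n c f = trans (∑-cong (cube n) (λ a → cong f (⊕-comm c a))) (∑-cube-⊕ n c f)

  pullback : Cube k → Vec (Fin k) n → Cube n
  pullback y h = Vec.map (lookup y) h

  embed≡⊕pullback : (a : Cube n) (h : Vec (Fin k) n) (y : Cube k) → embed a h y ≡ a ⊕ pullback y h
  embed≡⊕pullback []       []      y = refl
  embed≡⊕pullback (b ∷ a) (i ∷ h) y = cong₂ _∷_ (xor-comm (lookup y i) b) (embed≡⊕pullback a h y)

  pullback-⊕ : (u v : Cube k) (h : Vec (Fin k) n) → pullback (u ⊕ v) h ≡ pullback u h ⊕ pullback v h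
  pullback-⊕ u v []      = refl
  pullback-⊕ u v (i ∷ h) = cong₂ _∷_ (lookup-zipWith _xor_ i u v) (pullback-⊕ u v h)

  ∑-allVecs-map : (g : A → B) (xs : List A) (n : ℕ) (F : Vec B n → ℤ) →
                  ∑[ v ∈ allVecs xs n ] F (Vec.map g v) ≡ ∑ (allVecs (map g xs) n) F
  ∑-allVecs-map g xs zero    F = refl
  ∑-allVecs-map g xs (suc n) F = begin
    ∑[ v ∈ allVecs xs (suc n) ] F (Vec.map g v)
      ≡⟨ ∑-concatMap _ xs _ ⟩
    ∑[ x ∈ xs ] ∑[ v ∈ map (x ∷_) (allVecs xs n) ] F (Vec.map g v)
      ≡⟨ ∑-cong xs (λ x → trans (∑-map (x ∷_) (allVecs xs n) _) (∑-allVecs-map g xs n (λ v → F (g x ∷ v)))) ⟩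
    ∑[ x ∈ xs ] ∑[ v ∈ allVecs (map g xs) n ] F (g x ∷ v)
      ≡⟨ ∑-cong xs (λ x → ∑-map (g x ∷_) (allVecs (map g xs) n) F) ⟨
    ∑[ x ∈ xs ] ∑ (map (g x ∷_) (allVecs (map g xs) n)) F
      ≡⟨ ∑-map g xs _ ⟨
    ∑[ y ∈ map g xs ] ∑ (map (y ∷_) (allVecs (map g xs) n)) F
      ≡⟨ ∑-concatMap _ (map g xs) F ⟨
    ∑ (allVecs (map g xs) (suc n)) F ∎
    where open ≡-Reasoning

module FourierLevels where

  open import Data.Bool using (Bool; true; false; not)
  open import Data.Nat as ℕ using (ℕ; zero; suc)
  open import Data.Integer as ℤ using (ℤ; +_; 0ℤ; 1ℤ; _+_; _*_; -_; _-_; _^_; _≤_; ∣_∣)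
  import Data.Integer.Properties as ℤP
  open import Data.List using (List; []; _∷_; map; length)
  open import Data.Vec using (Vec; []; _∷_; zipWith; _∷ʳ_; head)
  open import Data.Vec.Relation.Unary.All as All using (All; []; _∷_)
  open import Relation.Binary.PropositionalEquality
  open import Data.Integer.Solver using (module +-*-Solver)
  open +-*-Solver
  open Sums
  open IntegerLemmas
  open BooleanCube

  private variable
    m n : ℕ

  sign : Bool → ℤ
  sign false = 1ℤ
  sign true  = - 1ℤ

  signSum : List Bool → ℤ
  signSum L = ∑ L sign

  2*∑-Bool : (L : List Bool) (g : Bool → ℤ) →
             + 2 * ∑ L g ≡ + length L * (g false + g true) + signSum L * (g false - g true)
  2*∑-Bool []         g = refl
  2*∑-Bool (false ∷ L) g rewrite ℤP.pos-+ 1 (length L) =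
    trans (ℤP.*-distribˡ-+ (+ 2) (g false) (∑ L g)) (trans (cong (λ s → + 2 * g false + s) (2*∑-Bool L g))
      (solve 4 (λ a b l r → con (+ 2) :* a :+ (l :* (a :+ b) :+ r :* (a :- b))
                         := (con 1ℤ :+ l) :* (a :+ b) :+ (con 1ℤ :+ r) :* (a :- b))
             refl (g false) (g true) (+ length L) (signSum L)))
  2*∑-Bool (true ∷ L) g rewrite ℤP.pos-+ 1 (length L) =
    trans (ℤP.*-distribˡ-+ (+ 2) (g true) (∑ L g)) (trans (cong (λ s → + 2 * g true + s) (2*∑-Bool L g))
      (solve 4 (λ a b l r → con (+ 2) :* b :+ (l :* (a :+ b) :+ r :* (a :- b))
                         := (con 1ℤ :+ l) :* (a :+ b) :+ (con (- 1ℤ) :+ r) :* (a :- b))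
             refl (g false) (g true) (+ length L) (signSum L)))

  pairSum : (n : ℕ) → List Bool → (Cube n → Cube n → ℤ) → ℤ
  pairSum n L H = ∑[ z ∈ allVecs L n ] ∑[ a ∈ cube n ] H a (a ⊕ z)

  pairSum-cong : (n : ℕ) (L : List Bool) {H H′ : Cube n → Cube n → ℤ} →
                 (∀ a b → H a b ≡ H′ a b) → pairSum n L H ≡ pairSum n L H′
  pairSum-cong n L H≗H′ = ∑-cong (allVecs L n) (λ z → ∑-cong (cube n) (λ a → H≗H′ a _))

  pairSum-+ : (n : ℕ) (L : List Bool) (H H′ : Cube n → Cube n → ℤ) →
              pairSum n L (λ a b → H a b + H′ a b) ≡ pairSum n L H + pairSum n L H′
  pairSum-+ n L H H′ = trans (∑-cong (allVecs L n) (λ z → ∑-+ (cube n) _ _)) (∑-+ (allVecs L n) _ _)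

  pairSum-neg : (n : ℕ) (L : List Bool) (H : Cube n → Cube n → ℤ) →
                pairSum n L (λ a b → - H a b) ≡ - pairSum n L H
  pairSum-neg n L H = trans (∑-cong (allVecs L n) (λ z → ∑-neg (cube n) _)) (∑-neg (allVecs L n) _)

  pairSum-suc : (n : ℕ) (L : List Bool) (H : Cube (suc n) → Cube (suc n) → ℤ) →
                pairSum (suc n) L H
                ≡ ∑[ b ∈ L ] (pairSum n L (λ a c → H (false ∷ a) (b ∷ c))
                              + pairSum n L (λ a c → H (true ∷ a) (not b ∷ c)))
  pairSum-suc n L H = trans (∑-concatMap (λ b → map (b ∷_) (allVecs L n)) L _)
    (∑-cong L (λ b → trans (∑-map (b ∷_) (allVecs L n) _)
      (trans (∑-cong (allVecs L n) (λ z → ∑-cube-suc n _)) (∑-+ (allVecs L n) _ _))))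

  correlation : (n : ℕ) → List Bool → (Cube n → ℤ) → (Cube n → ℤ) → ℤ
  correlation n L f g = pairSum n L (λ a b → f a * g b)

  fold⁺ fold⁻ : (Cube (suc n) → ℤ) → Cube n → ℤ
  fold⁺ f v = f (false ∷ v) + f (true ∷ v)
  fold⁻ f v = f (false ∷ v) - f (true ∷ v)

  slice : (n : ℕ) → List Bool → (Cube (suc n) → ℤ) → (Cube (suc n) → ℤ) → Bool → ℤ
  slice n L f g b = correlation n L (λ a → f (false ∷ a)) (λ c → g (b ∷ c))
                  + correlation n L (λ a → f (true ∷ a)) (λ c → g (not b ∷ c))

  correlation-suc : (n : ℕ) (L : List Bool) (f g : Cube (suc n) → ℤ) →
                    correlation (suc n) L f g ≡ ∑ L (slice n L f g)
  correlation-suc n L f g = pairSum-suc n L (λ a b → f a * g b)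

  module _ (n : ℕ) (L : List Bool) (f g : Cube (suc n) → ℤ) where
    private
      f₀ f₁ g₀ g₁ : Cube n → ℤ
      f₀ a = f (false ∷ a)
      f₁ a = f (true ∷ a)
      g₀ a = g (false ∷ a)
      g₁ a = g (true ∷ a)
      same cross : Cube n → Cube n → ℤ
      same  a b = f₀ a * g₀ b + f₁ a * g₁ b
      cross a b = f₀ a * g₁ b + f₁ a * g₀ b

    correlation-fold⁺ : correlation n L (fold⁺ f) (fold⁺ g) ≡ slice n L f g false + slice n L f g true
    correlation-fold⁺ = begin
      correlation n L (fold⁺ f) (fold⁺ g)
        ≡⟨ pairSum-cong n L (λ a b → solve 4 (λ x y u v → (x :+ y) :* (u :+ v) := (x :* u :+ y :* v) :+ (x :* v :+ y :* u))
                                            refl (f₀ a) (f₁ a) (g₀ b) (g₁ b)) ⟩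
      pairSum n L (λ a b → same a b + cross a b)
        ≡⟨ pairSum-+ n L same cross ⟩
      pairSum n L same + pairSum n L cross
        ≡⟨ cong₂ _+_ (pairSum-+ n L (λ a b → f₀ a * g₀ b) (λ a b → f₁ a * g₁ b))
                     (pairSum-+ n L (λ a b → f₀ a * g₁ b) (λ a b → f₁ a * g₀ b)) ⟩
      slice n L f g false + slice n L f g true ∎
      where open ≡-Reasoning

    correlation-fold⁻ : correlation n L (fold⁻ f) (fold⁻ g) ≡ slice n L f g false - slice n L f g true
    correlation-fold⁻ = begin
      correlation n L (fold⁻ f) (fold⁻ g)
        ≡⟨ pairSum-cong n L (λ a b → solve 4 (λ x y u v → (x :- y) :* (u :- v) := (x :* u :+ y :* v) :+ (:- (x :* v :+ y :* u)))
                                            refl (f₀ a) (f₁ a) (g₀ b) (g₁ b)) ⟩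
      pairSum n L (λ a b → same a b + - cross a b)
        ≡⟨ pairSum-+ n L same (λ a b → - cross a b) ⟩
      pairSum n L same + pairSum n L (λ a b → - cross a b)
        ≡⟨ cong₂ _+_ (pairSum-+ n L (λ a b → f₀ a * g₀ b) (λ a b → f₁ a * g₁ b))
                     (trans (pairSum-neg n L cross)
                            (cong -_ (pairSum-+ n L (λ a b → f₀ a * g₁ b) (λ a b → f₁ a * g₀ b)))) ⟩
      slice n L f g false - slice n L f g true ∎
      where open ≡-Reasoning

  2*correlation-suc : (n : ℕ) (L : List Bool) (f g : Cube (suc n) → ℤ) →
    + 2 * correlation (suc n) L f g
    ≡ + length L * correlation n L (fold⁺ f) (fold⁺ g) + signSum L * correlation n L (fold⁻ f) (fold⁻ g)
  2*correlation-suc n L f g = begin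
    + 2 * correlation (suc n) L f g
      ≡⟨ cong (+ 2 *_) (correlation-suc n L f g) ⟩
    + 2 * ∑ L (slice n L f g)
      ≡⟨ 2*∑-Bool L (slice n L f g) ⟩
    + length L * (slice n L f g false + slice n L f g true) + signSum L * (slice n L f g false - slice n L f g true)
      ≡⟨ cong₂ (λ s t → + length L * s + signSum L * t) (correlation-fold⁺ n L f g) (correlation-fold⁻ n L f g) ⟨
    + length L * correlation n L (fold⁺ f) (fold⁺ g) + signSum L * correlation n L (fold⁻ f) (fold⁻ g) ∎
    where open ≡-Reasoning

  evalHom : Vec ℤ m → ℤ → ℤ → ℤ
  evalHom {zero}  []       K R = 0ℤ
  evalHom {suc m} (c ∷ cs) K R = c * K ^ m + R * evalHom cs K R

  shiftAdd : Vec ℤ m → Vec ℤ m → Vec ℤ (suc m)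
  shiftAdd cs ds = zipWith _+_ (cs ∷ʳ 0ℤ) (0ℤ ∷ ds)

  evalHom-∷ʳ0 : (cs : Vec ℤ m) (K R : ℤ) → evalHom (cs ∷ʳ 0ℤ) K R ≡ K * evalHom cs K R
  evalHom-∷ʳ0 []               K R = solve 2 (λ K R → con 0ℤ :* con 1ℤ :+ R :* con 0ℤ := K :* con 0ℤ) refl K R
  evalHom-∷ʳ0 {suc m} (c ∷ cs) K R = trans (cong (λ s → c * (K * K ^ m) + R * s) (evalHom-∷ʳ0 cs K R))
    (solve 5 (λ c K R P e → c :* (K :* P) :+ R :* (K :* e) := K :* (c :* P :+ R :* e)) refl c K R (K ^ m) (evalHom cs K R))

  evalHom-zipWith-+ : (cs ds : Vec ℤ m) (K R : ℤ) →
                      evalHom (zipWith _+_ cs ds) K R ≡ evalHom cs K R + evalHom ds K R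
  evalHom-zipWith-+ []               []       K R = refl
  evalHom-zipWith-+ {suc m} (c ∷ cs) (d ∷ ds) K R =
    trans (cong (λ s → (c + d) * K ^ m + R * s) (evalHom-zipWith-+ cs ds K R))
      (solve 6 (λ c d R P a b → (c :+ d) :* P :+ R :* (a :+ b) := (c :* P :+ R :* a) :+ (d :* P :+ R :* b))
             refl c d R (K ^ m) (evalHom cs K R) (evalHom ds K R))

  evalHom-shiftAdd : (cs ds : Vec ℤ m) (K R : ℤ) →
                     evalHom (shiftAdd cs ds) K R ≡ K * evalHom cs K R + R * evalHom ds K R
  evalHom-shiftAdd {m} cs ds K R = begin
    evalHom (shiftAdd cs ds) K R
      ≡⟨ evalHom-zipWith-+ (cs ∷ʳ 0ℤ) (0ℤ ∷ ds) K R ⟩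
    evalHom (cs ∷ʳ 0ℤ) K R + (0ℤ * K ^ m + R * evalHom ds K R)
      ≡⟨ cong₂ _+_ (evalHom-∷ʳ0 cs K R) (trans (cong (_+ R * evalHom ds K R) (ℤP.*-zeroˡ (K ^ m))) (ℤP.+-identityˡ _)) ⟩
    K * evalHom cs K R + R * evalHom ds K R ∎
    where open ≡-Reasoning

  -- Entry j of levels n f g is Σ_{|S| = j} f̂(S) ĝ(S), where f̂(S) = Σ_a f a · (−1)^(Σ_{i ∈ S} a_i):
  -- fold⁺ f and fold⁻ f carry the coefficients of the characters without and with the first coordinate.
  -- Since Σ_{z ∈ Lⁿ} (−1)^(Σ_{i ∈ S} z_i) = (signSum L)^|S| (length L)^(n − |S|), evaluating the
  -- levels at these two numbers gives 2ⁿ times the correlation.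
  levels : (n : ℕ) → (Cube n → ℤ) → (Cube n → ℤ) → Vec ℤ (suc n)
  levels zero    f g = f [] * g [] ∷ []
  levels (suc n) f g = shiftAdd (levels n (fold⁺ f) (fold⁺ g)) (levels n (fold⁻ f) (fold⁻ g))

  2^n*correlation≡evalHom-levels : (n : ℕ) (L : List Bool) (f g : Cube n → ℤ) →
    (+ 2) ^ n * correlation n L f g ≡ evalHom (levels n f g) (+ length L) (signSum L)
  2^n*correlation≡evalHom-levels zero L f g =
    solve 3 (λ x K R → con 1ℤ :* ((x :+ con 0ℤ) :+ con 0ℤ) := x :* con 1ℤ :+ R :* con 0ℤ)
            refl (f [] * g []) (+ length L) (signSum L)
  2^n*correlation≡evalHom-levels (suc n) L f g = begin
    + 2 * (+ 2) ^ n * correlation (suc n) L f g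
      ≡⟨ solve 3 (λ a b c → a :* b :* c := b :* (a :* c)) refl (+ 2) ((+ 2) ^ n) (correlation (suc n) L f g) ⟩
    (+ 2) ^ n * (+ 2 * correlation (suc n) L f g)
      ≡⟨ cong ((+ 2) ^ n *_) (2*correlation-suc n L f g) ⟩
    (+ 2) ^ n * (K * correlation n L (fold⁺ f) (fold⁺ g) + R * correlation n L (fold⁻ f) (fold⁻ g))
      ≡⟨ solve 5 (λ t k r a b → t :* (k :* a :+ r :* b) := k :* (t :* a) :+ r :* (t :* b)) refl ((+ 2) ^ n) K R _ _ ⟩
    K * ((+ 2) ^ n * correlation n L (fold⁺ f) (fold⁺ g)) + R * ((+ 2) ^ n * correlation n L (fold⁻ f) (fold⁻ g))
      ≡⟨ cong₂ (λ s t → K * s + R * t) (2^n*correlation≡evalHom-levels n L (fold⁺ f) (fold⁺ g))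
                                        (2^n*correlation≡evalHom-levels n L (fold⁻ f) (fold⁻ g)) ⟩
    K * evalHom (levels n (fold⁺ f) (fold⁺ g)) K R + R * evalHom (levels n (fold⁻ f) (fold⁻ g)) K R
      ≡⟨ evalHom-shiftAdd (levels n (fold⁺ f) (fold⁺ g)) (levels n (fold⁻ f) (fold⁻ g)) K R ⟨
    evalHom (levels (suc n) f g) K R ∎
    where
    open ≡-Reasoning
    K R : ℤ
    K = + length L
    R = signSum L

  0≤levels : (n : ℕ) (f : Cube n → ℤ) → All (0ℤ ≤_) (levels n f f)
  0≤levels zero    f = 0≤i*i (f []) ∷ []
  0≤levels (suc n) f = All.zipWith (λ p q → ℤP.+-mono-≤ p q)
    (∷ʳ⁺ (0≤levels n (fold⁺ f)) ℤP.≤-refl) (ℤP.≤-refl ∷ 0≤levels n (fold⁻ f))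
    where
    ∷ʳ⁺ : {m : ℕ} {cs : Vec ℤ m} → All (0ℤ ≤_) cs → 0ℤ ≤ 0ℤ → All (0ℤ ≤_) (cs ∷ʳ 0ℤ)
    ∷ʳ⁺ []       p = p ∷ []
    ∷ʳ⁺ (q ∷ qs) p = q ∷ ∷ʳ⁺ qs p

  ∑-fold⁺ : (n : ℕ) (f : Cube (suc n) → ℤ) → ∑ (cube n) (fold⁺ f) ≡ ∑ (cube (suc n)) f
  ∑-fold⁺ n f = trans (∑-+ (cube n) _ _) (sym (∑-cube-suc n f))

  head-levels : (n : ℕ) (f : Cube n → ℤ) → head (levels n f f) ≡ ∑ (cube n) f * ∑ (cube n) f
  head-levels zero    f = cong₂ _*_ (sym (ℤP.+-identityʳ (f []))) (sym (ℤP.+-identityʳ (f [])))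
  head-levels (suc n) f with levels n (fold⁺ f) (fold⁺ f) | head-levels n (fold⁺ f)
  ... | c ∷ _ | c≡ = trans (ℤP.+-identityʳ c) (trans c≡ (cong₂ _*_ (∑-fold⁺ n f) (∑-fold⁺ n f)))

  sumᵥ : Vec ℤ m → ℤ
  sumᵥ []       = 0ℤ
  sumᵥ (c ∷ cs) = c + sumᵥ cs

  sumᵥ-shiftAdd : (cs ds : Vec ℤ m) → sumᵥ (shiftAdd cs ds) ≡ sumᵥ cs + sumᵥ ds
  sumᵥ-shiftAdd cs ds = trans (sumᵥ-zipWith-+ (cs ∷ʳ 0ℤ) (0ℤ ∷ ds))
    (cong₂ _+_ (sumᵥ-∷ʳ0 cs) (ℤP.+-identityˡ (sumᵥ ds)))
    where
    sumᵥ-∷ʳ0 : {m : ℕ} (cs : Vec ℤ m) → sumᵥ (cs ∷ʳ 0ℤ) ≡ sumᵥ cs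
    sumᵥ-∷ʳ0 []       = refl
    sumᵥ-∷ʳ0 (c ∷ cs) = cong (λ s → c + s) (sumᵥ-∷ʳ0 cs)
    sumᵥ-zipWith-+ : {m : ℕ} (cs ds : Vec ℤ m) → sumᵥ (zipWith _+_ cs ds) ≡ sumᵥ cs + sumᵥ ds
    sumᵥ-zipWith-+ []       []       = refl
    sumᵥ-zipWith-+ (c ∷ cs) (d ∷ ds) = trans (cong (λ s → c + d + s) (sumᵥ-zipWith-+ cs ds))
      (solve 4 (λ c d a b → (c :+ d) :+ (a :+ b) := (c :+ a) :+ (d :+ b)) refl c d (sumᵥ cs) (sumᵥ ds))

  sumᵥ-levels : (n : ℕ) (f : Cube n → ℤ) → sumᵥ (levels n f f) ≡ (+ 2) ^ n * ∑[ a ∈ cube n ] (f a * f a)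
  sumᵥ-levels zero    f = solve 1 (λ x → x :+ con 0ℤ := con 1ℤ :* (x :+ con 0ℤ)) refl (f [] * f [])
  sumᵥ-levels (suc n) f = begin
    sumᵥ (levels (suc n) f f)
      ≡⟨ sumᵥ-shiftAdd (levels n (fold⁺ f) (fold⁺ f)) _ ⟩
    sumᵥ (levels n (fold⁺ f) (fold⁺ f)) + sumᵥ (levels n (fold⁻ f) (fold⁻ f))
      ≡⟨ cong₂ _+_ (sumᵥ-levels n (fold⁺ f)) (sumᵥ-levels n (fold⁻ f)) ⟩
    (+ 2) ^ n * ∑[ a ∈ cube n ] (fold⁺ f a * fold⁺ f a) + (+ 2) ^ n * ∑[ a ∈ cube n ] (fold⁻ f a * fold⁻ f a)
      ≡⟨ ℤP.*-distribˡ-+ ((+ 2) ^ n) _ _ ⟨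
    (+ 2) ^ n * (∑[ a ∈ cube n ] (fold⁺ f a * fold⁺ f a) + ∑[ a ∈ cube n ] (fold⁻ f a * fold⁻ f a))
      ≡⟨ cong ((+ 2) ^ n *_) (trans (sym (∑-+ (cube n) _ _)) (∑-cong (cube n) parallelogram)) ⟩
    (+ 2) ^ n * ∑[ a ∈ cube n ] (+ 2 * (f (false ∷ a) * f (false ∷ a) + f (true ∷ a) * f (true ∷ a)))
      ≡⟨ cong ((+ 2) ^ n *_) (trans (∑-*ˡ (cube n) (+ 2) _)
                                    (cong (+ 2 *_) (trans (∑-+ (cube n) _ _) (sym (∑-cube-suc n _))))) ⟩
    (+ 2) ^ n * (+ 2 * ∑[ a ∈ cube (suc n) ] (f a * f a))
      ≡⟨ solve 3 (λ p t c → p :* (t :* c) := t :* p :* c) refl ((+ 2) ^ n) (+ 2) _ ⟩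
    (+ 2) ^ suc n * ∑[ a ∈ cube (suc n) ] (f a * f a) ∎
    where
    open ≡-Reasoning
    parallelogram : (a : Cube n) → fold⁺ f a * fold⁺ f a + fold⁻ f a * fold⁻ f a
                                   ≡ + 2 * (f (false ∷ a) * f (false ∷ a) + f (true ∷ a) * f (true ∷ a))
    parallelogram a = solve 2 (λ x y → (x :+ y) :* (x :+ y) :+ (x :- y) :* (x :- y) := con (+ 2) :* (x :* x :+ y :* y))
                            refl (f (false ∷ a)) (f (true ∷ a))

  ∣K*evalHom∣≤ : (cs : Vec ℤ m) (K R : ℤ) → All (0ℤ ≤_) cs → 0ℤ ≤ K → + ∣ R ∣ ≤ K →
                 + ∣ K * evalHom cs K R ∣ ≤ sumᵥ cs * K ^ m
  ∣K*evalHom∣≤ []               K R []         0≤K ∣R∣≤K rewrite ℤP.*-zeroʳ K = ℤP.≤-refl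
  ∣K*evalHom∣≤ {suc m} (c ∷ cs) K R (0≤c ∷ 0≤cs) 0≤K ∣R∣≤K =
    subst₂ (λ s t → + ∣ s ∣ ≤ t)
      (solve 5 (λ K c P R e → c :* (K :* P) :+ R :* (K :* e) := K :* (c :* P :+ R :* e)) refl K c (K ^ m) R (evalHom cs K R))
      (solve 4 (λ K c P S → c :* (K :* P) :+ K :* (S :* P) := (c :+ S) :* (K :* P)) refl K c (K ^ m) (sumᵥ cs))
      (∣i+j∣≤ {c * (K * K ^ m)} {R * (K * evalHom cs K R)}
              (ℤP.≤-reflexive (ℤP.0≤i⇒+∣i∣≡i (0≤i*j 0≤c (0≤i^n (suc m) 0≤K))))
              (∣i*j∣≤ {R} ∣R∣≤K (∣K*evalHom∣≤ cs K R 0≤cs 0≤K ∣R∣≤K)))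

  K*evalHom≤quadratic : (c d : ℤ) (cs : Vec ℤ m) (K R : ℤ) → All (0ℤ ≤_) cs → 0ℤ ≤ K → + ∣ R ∣ ≤ K →
    K * evalHom (c ∷ d ∷ cs) K R ≤ c * K ^ (2 ℕ.+ m) + R * d * K ^ (1 ℕ.+ m) + R * R * (sumᵥ cs * K ^ m)
  K*evalHom≤quadratic {m} c d cs K R 0≤cs 0≤K ∣R∣≤K =
    subst (_≤ c * K ^ (2 ℕ.+ m) + R * d * K ^ (1 ℕ.+ m) + R * R * (sumᵥ cs * K ^ m))
      (solve 6 (λ K c d R P e → c :* (K :* (K :* P)) :+ R :* d :* (K :* P) :+ R :* R :* (K :* e)
                             := K :* (c :* (K :* P) :+ R :* (d :* P :+ R :* e))) refl K c d R (K ^ m) (evalHom cs K R))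
      (ℤP.+-monoʳ-≤ (c * K ^ (2 ℕ.+ m) + R * d * K ^ (1 ℕ.+ m))
        (ℤP.*-monoˡ-≤-nonNeg (R * R) {{ℤ.nonNegative (0≤i*i R)}}
          (ℤP.≤-trans (i≤∣i∣ (K * evalHom cs K R)) (∣K*evalHom∣≤ cs K R 0≤cs 0≤K ∣R∣≤K))))

module Bias where

  open import Data.Bool using (Bool; true; false)
  open import Data.Nat as ℕ using (ℕ; zero; suc)
  open import Data.Integer as ℤ using (ℤ; +_; 0ℤ; 1ℤ; _+_; _*_; -_; _-_; _^_; _≤_; +≤+; ∣_∣)
  import Data.Integer.Properties as ℤP
  import Data.Fin as Fin
  open import Data.List using (List; []; _∷_; map; allFin; length)
  import Data.List.Properties as List
  open import Data.Vec using (Vec; []; _∷_; lookup)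
  import Data.Vec
  open import Data.Vec.Relation.Unary.All using (All; []; _∷_)
  open import Relation.Binary.PropositionalEquality
  open import Data.Integer.Solver using (module +-*-Solver)
  open +-*-Solver
  open Sums
  open IntegerLemmas
  open BooleanCube
  open FourierLevels

  private variable
    m : ℕ

  entries : {k : ℕ} → Vec Bool k → List Bool
  entries {k} w = map (lookup w) (allFin k)

  length-entries : {k : ℕ} (w : Vec Bool k) → length (entries w) ≡ k
  length-entries {k} w = trans (List.length-map (lookup w) (allFin k)) (List.length-tabulate (λ i → i))

  entries-∷ : {k : ℕ} (b : Bool) (w : Vec Bool k) → entries (b ∷ w) ≡ b ∷ entries w
  entries-∷ {k} b w = cong (b ∷_) (trans (List.map-tabulate Fin.suc (lookup (b ∷ w)))
                                          (sym (List.map-tabulate (λ i → i) (lookup w))))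

  bias : {k : ℕ} → Vec Bool k → ℤ
  bias w = signSum (entries w)

  bias-∷ : {k : ℕ} (b : Bool) (w : Vec Bool k) → bias (b ∷ w) ≡ sign b + bias w
  bias-∷ b w = cong signSum (entries-∷ b w)

  ∣bias∣≤k : (k : ℕ) (w : Vec Bool k) → + ∣ bias w ∣ ≤ + k
  ∣bias∣≤k zero    []      = ℤP.≤-refl
  ∣bias∣≤k (suc k) (b ∷ w) rewrite bias-∷ b w =
    subst (+ ∣ sign b + bias w ∣ ≤_) (sym (ℤP.pos-+ 1 k)) (∣i+j∣≤ {sign b} (∣sign∣≤1 b) (∣bias∣≤k k w))
    where
    ∣sign∣≤1 : (b : Bool) → + ∣ sign b ∣ ≤ 1ℤ
    ∣sign∣≤1 false = ℤP.≤-refl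
    ∣sign∣≤1 true  = ℤP.≤-refl

  ∑-bias : (k : ℕ) → ∑[ w ∈ cube k ] bias w ≡ 0ℤ
  ∑-bias zero    = refl
  ∑-bias (suc k) = begin
    ∑[ w ∈ cube (suc k) ] bias w
      ≡⟨ ∑-cube-suc k bias ⟩
    ∑[ w ∈ cube k ] bias (false ∷ w) + ∑[ w ∈ cube k ] bias (true ∷ w)
      ≡⟨ cong₂ _+_ (∑-cong (cube k) (bias-∷ false)) (∑-cong (cube k) (bias-∷ true)) ⟩
    ∑[ w ∈ cube k ] (1ℤ + bias w) + ∑[ w ∈ cube k ] (- 1ℤ + bias w)
      ≡⟨ cong₂ _+_ (∑-+ (cube k) _ bias) (∑-+ (cube k) _ bias) ⟩
    (∑[ _ ∈ cube k ] 1ℤ + ∑ (cube k) bias) + (∑[ _ ∈ cube k ] (- 1ℤ) + ∑ (cube k) bias)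
      ≡⟨ cong₂ (λ s t → (s + ∑ (cube k) bias) + (t + ∑ (cube k) bias)) (∑-cube-const k 1ℤ) (∑-cube-const k (- 1ℤ)) ⟩
    ((+ 2) ^ k * 1ℤ + ∑ (cube k) bias) + ((+ 2) ^ k * - 1ℤ + ∑ (cube k) bias)
      ≡⟨ cong (λ s → ((+ 2) ^ k * 1ℤ + s) + ((+ 2) ^ k * - 1ℤ + s)) (∑-bias k) ⟩
    ((+ 2) ^ k * 1ℤ + 0ℤ) + ((+ 2) ^ k * - 1ℤ + 0ℤ)
      ≡⟨ solve 1 (λ p → (p :* con 1ℤ :+ con 0ℤ) :+ (p :* con (- 1ℤ) :+ con 0ℤ) := con 0ℤ) refl ((+ 2) ^ k) ⟩
    0ℤ ∎
    where open ≡-Reasoning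

  ∑-bias² : (k : ℕ) → ∑[ w ∈ cube k ] (bias w * bias w) ≡ (+ 2) ^ k * + k
  ∑-bias² zero    = refl
  ∑-bias² (suc k) = begin
    ∑[ w ∈ cube (suc k) ] (bias w * bias w)
      ≡⟨ ∑-cube-suc k _ ⟩
    ∑[ w ∈ cube k ] (bias (false ∷ w) * bias (false ∷ w)) + ∑[ w ∈ cube k ] (bias (true ∷ w) * bias (true ∷ w))
      ≡⟨ ∑-+ (cube k) _ _ ⟨
    ∑[ w ∈ cube k ] (bias (false ∷ w) * bias (false ∷ w) + bias (true ∷ w) * bias (true ∷ w))
      ≡⟨ ∑-cong (cube k) squares ⟩
    ∑[ w ∈ cube k ] (+ 2 + + 2 * (bias w * bias w))
      ≡⟨ ∑-+ (cube k) _ _ ⟩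
    ∑[ _ ∈ cube k ] (+ 2) + ∑[ w ∈ cube k ] (+ 2 * (bias w * bias w))
      ≡⟨ cong₂ _+_ (∑-cube-const k (+ 2)) (trans (∑-*ˡ (cube k) (+ 2) _) (cong (+ 2 *_) (∑-bias² k))) ⟩
    (+ 2) ^ k * + 2 + + 2 * ((+ 2) ^ k * + k)
      ≡⟨ solve 2 (λ p k → p :* con (+ 2) :+ con (+ 2) :* (p :* k) := con (+ 2) :* p :* (con 1ℤ :+ k)) refl ((+ 2) ^ k) (+ k) ⟩
    (+ 2) ^ suc k * (1ℤ + + k)
      ≡⟨ cong ((+ 2) ^ suc k *_) (sym (ℤP.pos-+ 1 k)) ⟩
    (+ 2) ^ suc k * + suc k ∎
    where
    open ≡-Reasoning
    squares : (w : Vec Bool k) → bias (false ∷ w) * bias (false ∷ w) + bias (true ∷ w) * bias (true ∷ w)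
                                 ≡ + 2 + + 2 * (bias w * bias w)
    squares w rewrite bias-∷ false w | bias-∷ true w =
      solve 1 (λ r → (con 1ℤ :+ r) :* (con 1ℤ :+ r) :+ (con (- 1ℤ) :+ r) :* (con (- 1ℤ) :+ r)
                  := con (+ 2) :+ con (+ 2) :* (r :* r)) refl (bias w)

  -- Averaging over w kills the term linear in bias w and replaces (bias w)² by k.
  k*∑-evalHom-bias≤ : (k : ℕ) (c d : ℤ) (cs : Vec ℤ m) → All (0ℤ ≤_) cs →
    + k * ∑[ w ∈ cube k ] evalHom (c ∷ d ∷ cs) (+ k) (bias w)
      ≤ (+ 2) ^ k * (c * (+ k) ^ (2 ℕ.+ m) + sumᵥ cs * (+ k) ^ (1 ℕ.+ m))
  k*∑-evalHom-bias≤ {m} k c d cs 0≤cs = begin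
    K * ∑[ w ∈ cube k ] evalHom (c ∷ d ∷ cs) K (bias w)
      ≡⟨ ∑-*ˡ (cube k) K _ ⟨
    ∑[ w ∈ cube k ] (K * evalHom (c ∷ d ∷ cs) K (bias w))
      ≤⟨ ∑-mono-≤ (cube k) (λ w → K*evalHom≤quadratic c d cs K (bias w) 0≤cs (+≤+ ℕ.z≤n) (∣bias∣≤k k w)) ⟩
    ∑[ w ∈ cube k ] (c * K ^ (2 ℕ.+ m) + bias w * d * K ^ (1 ℕ.+ m) + bias w * bias w * S)
      ≡⟨ ∑-cong (cube k) (λ w → solve 5 (λ A R d B S → A :+ R :* d :* B :+ R :* R :* S := A :+ (d :* B :* R :+ S :* (R :* R)))
                                       refl (c * K ^ (2 ℕ.+ m)) (bias w) d (K ^ (1 ℕ.+ m)) S) ⟩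
    ∑[ w ∈ cube k ] (c * K ^ (2 ℕ.+ m) + (d * K ^ (1 ℕ.+ m) * bias w + S * (bias w * bias w)))
      ≡⟨ trans (∑-+ (cube k) _ _) (cong₂ _+_ (∑-cube-const k _) (trans (∑-+ (cube k) (λ w → d * K ^ (1 ℕ.+ m) * bias w) _)
           (cong₂ _+_ (trans (∑-*ˡ (cube k) (d * K ^ (1 ℕ.+ m)) bias) (cong (d * K ^ (1 ℕ.+ m) *_) (∑-bias k)))
                      (trans (∑-*ˡ (cube k) S _) (cong (S *_) (∑-bias² k)))))) ⟩
    Q * (c * K ^ (2 ℕ.+ m)) + (d * K ^ (1 ℕ.+ m) * 0ℤ + S * (Q * K))
      ≡⟨ solve 6 (λ Q A B s P K → Q :* A :+ (B :* con 0ℤ :+ s :* P :* (Q :* K)) := Q :* (A :+ s :* (K :* P)))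
               refl Q (c * K ^ (2 ℕ.+ m)) (d * K ^ (1 ℕ.+ m)) (sumᵥ cs) (K ^ m) K ⟩
    Q * (c * K ^ (2 ℕ.+ m) + sumᵥ cs * K ^ (1 ℕ.+ m)) ∎
    where
    open ℤP.≤-Reasoning
    K Q S : ℤ
    K = + k
    Q = (+ 2) ^ k
    S = sumᵥ cs * K ^ m

  k*∑-correlation≤ : (m k : ℕ) (f : Cube (suc m) → ℤ) →
    let P = (+ 2) ^ suc m ; τ = ∑ (cube (suc m)) f ; K = + k in
    K * (P * ∑[ w ∈ cube k ] correlation (suc m) (entries w) f f)
      ≤ (+ 2) ^ k * (τ * τ * K ^ (2 ℕ.+ m) + (P * ∑[ a ∈ cube (suc m) ] (f a * f a) - τ * τ) * K ^ (1 ℕ.+ m))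
  k*∑-correlation≤ m k f = begin
    K * (P * ∑[ w ∈ cube k ] correlation (suc m) (entries w) f f)
      ≡⟨ cong (K *_) (trans (sym (∑-*ˡ (cube k) P _)) (∑-cong (cube k) P*correlation≡)) ⟩
    K * ∑[ w ∈ cube k ] evalHom (levels (suc m) f f) K (bias w)
      ≤⟨ averaged (levels (suc m) f f) (0≤levels (suc m) f) (head-levels (suc m) f) (sumᵥ-levels (suc m) f) ⟩
    (+ 2) ^ k * (τ * τ * K ^ (2 ℕ.+ m) + (P * S - τ * τ) * K ^ (1 ℕ.+ m)) ∎
    where
    open ℤP.≤-Reasoning
    P τ K S : ℤ
    P = (+ 2) ^ suc m
    τ = ∑ (cube (suc m)) f
    K = + k
    S = ∑[ a ∈ cube (suc m) ] (f a * f a)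
    P*correlation≡ : (w : Cube k) → P * correlation (suc m) (entries w) f f ≡ evalHom (levels (suc m) f f) K (bias w)
    P*correlation≡ w = trans (2^n*correlation≡evalHom-levels (suc m) (entries w) f f)
                             (cong (λ l → evalHom (levels (suc m) f f) (+ l) (bias w)) (length-entries w))
    averaged : (vs : Vec ℤ (2 ℕ.+ m)) → All (0ℤ ≤_) vs → Data.Vec.head vs ≡ τ * τ → sumᵥ vs ≡ P * S →
               K * ∑[ w ∈ cube k ] evalHom vs K (bias w)
                 ≤ (+ 2) ^ k * (τ * τ * K ^ (2 ℕ.+ m) + (P * S - τ * τ) * K ^ (1 ℕ.+ m))
    averaged (c ∷ d ∷ cs) (_ ∷ 0≤d ∷ 0≤cs) refl sum≡ =
      ℤP.≤-trans (k*∑-evalHom-bias≤ k c d cs 0≤cs)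
        (ℤP.*-monoˡ-≤-nonNeg ((+ 2) ^ k) {{ℤ.nonNegative (0≤i^n k (+≤+ ℕ.z≤n))}}
          (ℤP.+-monoʳ-≤ (c * K ^ (2 ℕ.+ m))
            (ℤP.*-monoʳ-≤-nonNeg (K ^ (1 ℕ.+ m)) {{ℤ.nonNegative (0≤i^n (1 ℕ.+ m) (+≤+ ℕ.z≤n))}} sum-cs≤)))
      where
      sum-cs≤ : sumᵥ cs ≤ P * S - c
      sum-cs≤ = subst (sumᵥ cs ≤_)
        (trans (solve 3 (λ c d s → s :+ d := (c :+ (d :+ s)) :- c) refl c d (sumᵥ cs)) (cong (_- c) sum≡))
        (ℤP.≤-trans (ℤP.≤-reflexive (sym (ℤP.+-identityʳ (sumᵥ cs)))) (ℤP.+-monoʳ-≤ (sumᵥ cs) 0≤d))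

module SecondMoment where

  open import Data.Bool using (Bool; true; false)
  import Data.Bool as Bool
  open import Data.Nat as ℕ using (ℕ; suc)
  open import Data.Integer as ℤ using (ℤ; +_; 0ℤ; _+_; _*_; -_; _-_; _^_; _≤_; +≤+)
  import Data.Integer.Properties as ℤP
  open import Data.Fin using (Fin)
  open import Data.List using (List; allFin; length)
  import Data.List.Properties as List
  open import Data.Vec using (Vec; lookup)
  open import Data.Product using (_×_; _,_)
  open import Relation.Binary.PropositionalEquality
  open import Data.Integer.Solver using (module +-*-Solver)
  open +-*-Solver
  open Sums
  open IntegerLemmas
  open BooleanCube
  open FourierLevels
  open Bias

  module Sampling (n k : ℕ) (T : Cube n → Bool) where

    t : Cube n → ℤ
    t x = 𝟙 (T x)

    hashes : List (Vec (Fin k) n)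
    hashes = allVecs (allFin k) n

    hits : Cube n → Vec (Fin k) n → ℤ
    hits a h = ∑[ y ∈ cube k ] t (a ⊕ pullback y h)

    ∑ₛ : (Cube n → Vec (Fin k) n → ℤ) → ℤ
    ∑ₛ F = ∑[ a ∈ cube n ] ∑[ h ∈ hashes ] F a h

    P Q K τ : ℤ
    P = (+ 2) ^ n
    Q = (+ 2) ^ k
    K = + k
    τ = ∑ (cube n) t

    card≡τ : + card T ≡ τ
    card≡τ = trans (length-filter≡∑ (λ x → T x Bool.≟ true) (cube n)) (∑-cong (cube n) (λ x → 𝟙-does-≟-true (T x)))

    cardInCube≡hits : (a : Cube n) (h : Vec (Fin k) n) → + cardInCube T a h ≡ hits a h
    cardInCube≡hits a h = trans (length-filter≡∑ (λ y → T (embed a h y) Bool.≟ true) (cube k))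
      (∑-cong (cube k) (λ y → trans (𝟙-does-≟-true (T (embed a h y))) (cong t (embed≡⊕pullback a h y))))

    ∑-samples : (F : Cube n × Vec (Fin k) n → ℤ) → ∑ (samples n k) F ≡ ∑ₛ (λ a h → F (a , h))
    ∑-samples F = trans (∑-concatMap _ (cube n) F) (∑-cong (cube n) (λ a → ∑-map (a ,_) hashes F))

    length-hashes : + length hashes ≡ K ^ n
    length-hashes = trans (cong +_ (trans (length-allVecs (allFin k) n) (cong (ℕ._^ n) (List.length-tabulate (λ i → i)))))
                          (pos-^ k n)

    ∑ₛ-const : (c : ℤ) → ∑ₛ (λ _ _ → c) ≡ P * K ^ n * c
    ∑ₛ-const c = begin
      ∑[ a ∈ cube n ] ∑[ h ∈ hashes ] c ≡⟨ ∑-cong (cube n) (λ a → ∑-const hashes c) ⟩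
      ∑[ a ∈ cube n ] (+ length hashes * c) ≡⟨ ∑-cube-const n _ ⟩
      P * (+ length hashes * c)         ≡⟨ cong (λ l → P * (l * c)) length-hashes ⟩
      P * (K ^ n * c)                   ≡⟨ ℤP.*-assoc P (K ^ n) c ⟨
      P * K ^ n * c ∎
      where open ≡-Reasoning

    ∑ₛ-+ : (F G : Cube n → Vec (Fin k) n → ℤ) → ∑ₛ (λ a h → F a h + G a h) ≡ ∑ₛ F + ∑ₛ G
    ∑ₛ-+ F G = trans (∑-cong (cube n) (λ a → ∑-+ hashes _ _)) (∑-+ (cube n) _ _)

    ∑ₛ-*ˡ : (c : ℤ) (F : Cube n → Vec (Fin k) n → ℤ) → ∑ₛ (λ a h → c * F a h) ≡ c * ∑ₛ F
    ∑ₛ-*ˡ c F = trans (∑-cong (cube n) (λ a → ∑-*ˡ hashes c _)) (∑-*ˡ (cube n) c _)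

    ∑ₛ-hits : ∑ₛ hits ≡ K ^ n * (Q * τ)
    ∑ₛ-hits = begin
      ∑[ a ∈ cube n ] ∑[ h ∈ hashes ] hits a h
        ≡⟨ ∑-comm (cube n) hashes _ ⟩
      ∑[ h ∈ hashes ] ∑[ a ∈ cube n ] ∑[ y ∈ cube k ] t (a ⊕ pullback y h)
        ≡⟨ ∑-cong hashes (λ h → ∑-comm (cube n) (cube k) _) ⟩
      ∑[ h ∈ hashes ] ∑[ y ∈ cube k ] ∑[ a ∈ cube n ] t (a ⊕ pullback y h)
        ≡⟨ ∑-cong hashes (λ h → ∑-cong (cube k) (λ y → ∑-cube-⊕ n (pullback y h) t)) ⟩
      ∑[ h ∈ hashes ] ∑[ y ∈ cube k ] τ
        ≡⟨ ∑-cong hashes (λ h → ∑-cube-const k τ) ⟩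
      ∑[ h ∈ hashes ] (Q * τ)
        ≡⟨ trans (∑-const hashes _) (cong (_* (Q * τ)) length-hashes) ⟩
      K ^ n * (Q * τ) ∎
      where open ≡-Reasoning

    ∑ₛ-hits² : ∑ₛ (λ a h → hits a h * hits a h) ≡ Q * ∑[ w ∈ cube k ] correlation n (entries w) t t
    ∑ₛ-hits² = begin
      ∑[ a ∈ cube n ] ∑[ h ∈ hashes ] (hits a h * hits a h)
        ≡⟨ ∑-comm (cube n) hashes _ ⟩
      ∑[ h ∈ hashes ] ∑[ a ∈ cube n ] (hits a h * hits a h)
        ≡⟨ ∑-cong hashes (λ h → ∑-cong (cube n) (λ a → ∑*∑ (cube k) (cube k) _ _)) ⟩
      ∑[ h ∈ hashes ] ∑[ a ∈ cube n ] ∑[ y ∈ cube k ] ∑[ y′ ∈ cube k ]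
        (t (a ⊕ pullback y h) * t (a ⊕ pullback y′ h))
        ≡⟨ ∑-cong hashes (λ h → trans (∑-comm (cube n) (cube k) _) (∑-cong (cube k) (λ y → ∑-comm (cube n) (cube k) _))) ⟩
      ∑[ h ∈ hashes ] ∑[ y ∈ cube k ] ∑[ y′ ∈ cube k ] ∑[ a ∈ cube n ]
        (t (a ⊕ pullback y h) * t (a ⊕ pullback y′ h))
        ≡⟨ ∑-cong hashes (λ h → ∑-cong (cube k) (λ y → trans (∑-cong (cube k) (shift h y)) (∑-cube-⊕ˡ k y (G h)))) ⟩
      ∑[ h ∈ hashes ] ∑[ y ∈ cube k ] ∑ (cube k) (G h)
        ≡⟨ ∑-cong hashes (λ h → ∑-cube-const k _) ⟩
      ∑[ h ∈ hashes ] (Q * ∑ (cube k) (G h))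
        ≡⟨ ∑-*ˡ hashes Q _ ⟩
      Q * ∑[ h ∈ hashes ] ∑[ w ∈ cube k ] G h w
        ≡⟨ cong (Q *_) (∑-comm hashes (cube k) G) ⟩
      Q * ∑[ w ∈ cube k ] ∑[ h ∈ hashes ] G h w
        ≡⟨ cong (Q *_) (∑-cong (cube k) (λ w → ∑-allVecs-map (lookup w) (allFin k) n (λ v → ∑[ a ∈ cube n ] (t a * t (a ⊕ v))))) ⟩
      Q * ∑[ w ∈ cube k ] correlation n (entries w) t t ∎
      where
      open ≡-Reasoning
      G : Vec (Fin k) n → Cube k → ℤ
      G h w = ∑[ a ∈ cube n ] (t a * t (a ⊕ pullback w h))
      shift : (h : Vec (Fin k) n) (y y′ : Cube k) →
              ∑[ a ∈ cube n ] (t (a ⊕ pullback y h) * t (a ⊕ pullback y′ h)) ≡ G h (y ⊕ y′)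
      shift h y y′ = sym (begin
        ∑[ a ∈ cube n ] (t a * t (a ⊕ pullback (y ⊕ y′) h))
          ≡⟨ ∑-cube-⊕ n (pullback y h) _ ⟨
        ∑[ a ∈ cube n ] (t (a ⊕ pullback y h) * t ((a ⊕ pullback y h) ⊕ pullback (y ⊕ y′) h))
          ≡⟨ ∑-cong (cube n) (λ a → cong (λ z → t (a ⊕ pullback y h) * t z)
               (trans (cong ((a ⊕ pullback y h) ⊕_) (pullback-⊕ y y′ h)) (⊕-telescope a (pullback y h) (pullback y′ h)))) ⟩
        ∑[ a ∈ cube n ] (t (a ⊕ pullback y h) * t (a ⊕ pullback y′ h)) ∎)

    -- deviation a h = 2ⁿ 2ᵏ (|T ∩ C_{a,h}| / 2ᵏ − μ)
    deviation : Cube n → Vec (Fin k) n → ℤ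
    deviation a h = P * hits a h - Q * τ

    ∑ₛ-deviation² : ∑ₛ (λ a h → deviation a h * deviation a h)
                    ≡ P * P * (Q * ∑[ w ∈ cube k ] correlation n (entries w) t t) - P * K ^ n * (Q * Q * (τ * τ))
    ∑ₛ-deviation² = begin
      ∑ₛ (λ a h → deviation a h * deviation a h)
        ≡⟨ ∑-cong (cube n) (λ a → ∑-cong hashes (λ h → expand (hits a h))) ⟩
      ∑ₛ (λ a h → P * P * (hits a h * hits a h) + - (+ 2 * P * Q * τ) * hits a h + Q * Q * (τ * τ))
        ≡⟨ trans (∑ₛ-+ _ _) (cong (_+ ∑ₛ (λ _ _ → Q * Q * (τ * τ))) (∑ₛ-+ _ _)) ⟩
      ∑ₛ (λ a h → P * P * (hits a h * hits a h)) + ∑ₛ (λ a h → - (+ 2 * P * Q * τ) * hits a h)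
        + ∑ₛ (λ _ _ → Q * Q * (τ * τ))
        ≡⟨ cong₂ _+_ (cong₂ _+_ (trans (∑ₛ-*ˡ (P * P) _) (cong (P * P *_) ∑ₛ-hits²))
                                (trans (∑ₛ-*ˡ (- (+ 2 * P * Q * τ)) hits) (cong (- (+ 2 * P * Q * τ) *_) ∑ₛ-hits)))
                     (∑ₛ-const _) ⟩
      P * P * (Q * X) + - (+ 2 * P * Q * τ) * (K ^ n * (Q * τ)) + P * K ^ n * (Q * Q * (τ * τ))
        ≡⟨ solve 5 (λ P Q X τ N → P :* P :* (Q :* X) :+ (:- (con (+ 2) :* P :* Q :* τ)) :* (N :* (Q :* τ))
                                 :+ P :* N :* (Q :* Q :* (τ :* τ))
                               := P :* P :* (Q :* X) :- P :* N :* (Q :* Q :* (τ :* τ))) refl P Q X τ (K ^ n) ⟩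
      P * P * (Q * X) - P * K ^ n * (Q * Q * (τ * τ)) ∎
      where
      open ≡-Reasoning
      X : ℤ
      X = ∑[ w ∈ cube k ] correlation n (entries w) t t
      expand : (c : ℤ) → (P * c - Q * τ) * (P * c - Q * τ) ≡ P * P * (c * c) + - (+ 2 * P * Q * τ) * c + Q * Q * (τ * τ)
      expand c = solve 4 (λ P Q τ c → (P :* c :- Q :* τ) :* (P :* c :- Q :* τ)
                                    := P :* P :* (c :* c) :+ (:- (con (+ 2) :* P :* Q :* τ)) :* c :+ Q :* Q :* (τ :* τ))
                       refl P Q τ c

    t*t≡t : (a : Cube n) → t a * t a ≡ t a
    t*t≡t a with T a
    ... | true  = refl
    ... | false = refl

  4k*∑ₛ-deviation²≤ : (m k : ℕ) (T : Cube (suc m) → Bool) → let open Sampling (suc m) k T in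
    + 4 * K * ∑ₛ (λ a h → deviation a h * deviation a h) ≤ P * K ^ suc m * ((P * Q) * (P * Q))
  4k*∑ₛ-deviation²≤ m k T = begin
    + 4 * K * ∑ₛ (λ a h → deviation a h * deviation a h)
      ≡⟨ cong (+ 4 * K *_) ∑ₛ-deviation² ⟩
    + 4 * K * (P * P * (Q * X) - P * K ^ suc m * (Q * Q * (τ * τ)))
      ≡⟨ solve 6 (λ K P Q X τ N → con (+ 4) :* K :* (P :* P :* (Q :* X) :- P :* N :* (Q :* Q :* (τ :* τ)))
                              := con (+ 4) :* P :* Q :* (K :* (P :* X)) :- con (+ 4) :* P :* Q :* Q :* (τ :* τ) :* (K :* N))
               refl K P Q X τ (K ^ suc m) ⟩
    + 4 * P * Q * (K * (P * X)) - + 4 * P * Q * Q * (τ * τ) * K ^ (2 ℕ.+ m)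
      ≤⟨ ℤP.+-monoˡ-≤ (- (+ 4 * P * Q * Q * (τ * τ) * K ^ (2 ℕ.+ m)))
           (ℤP.*-monoˡ-≤-nonNeg (+ 4 * P * Q) {{ℤ.nonNegative 0≤4PQ}} (k*∑-correlation≤ m k t)) ⟩
    + 4 * P * Q * (Q * (τ * τ * K ^ (2 ℕ.+ m) + (P * ∑[ a ∈ cube (suc m) ] (t a * t a) - τ * τ) * K ^ (1 ℕ.+ m)))
      - + 4 * P * Q * Q * (τ * τ) * K ^ (2 ℕ.+ m)
      ≡⟨ cong (λ s → + 4 * P * Q * (Q * (τ * τ * K ^ (2 ℕ.+ m) + (P * s - τ * τ) * K ^ (1 ℕ.+ m)))
                     - + 4 * P * Q * Q * (τ * τ) * K ^ (2 ℕ.+ m))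
              (∑-cong (cube (suc m)) t*t≡t) ⟩
    + 4 * P * Q * (Q * (τ * τ * K ^ (2 ℕ.+ m) + (P * τ - τ * τ) * K ^ (1 ℕ.+ m)))
      - + 4 * P * Q * Q * (τ * τ) * K ^ (2 ℕ.+ m)
      ≡⟨ solve 6 (λ P Q a N b K → con (+ 4) :* P :* Q :* (Q :* (a :* (K :* N) :+ b :* N))
                                :- con (+ 4) :* P :* Q :* Q :* a :* (K :* N)
                              := P :* Q :* Q :* N :* (con (+ 4) :* b))
               refl P Q (τ * τ) (K ^ suc m) (P * τ - τ * τ) K ⟩
    P * Q * Q * K ^ suc m * (+ 4 * (P * τ - τ * τ))
      ≤⟨ ℤP.*-monoˡ-≤-nonNeg (P * Q * Q * K ^ suc m) {{ℤ.nonNegative 0≤PQQKⁿ}} (4*τ*[P-τ]≤P² P τ) ⟩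
    P * Q * Q * K ^ suc m * (P * P)
      ≡⟨ solve 3 (λ P Q N → P :* Q :* Q :* N :* (P :* P) := P :* N :* (P :* Q :* (P :* Q))) refl P Q (K ^ suc m) ⟩
    P * K ^ suc m * ((P * Q) * (P * Q)) ∎
    where
    open Sampling (suc m) k T
    open ℤP.≤-Reasoning
    X : ℤ
    X = ∑[ w ∈ cube k ] correlation (suc m) (entries w) t t
    0≤P : 0ℤ ≤ P
    0≤P = 0≤i^n (suc m) (+≤+ ℕ.z≤n)
    0≤Q : 0ℤ ≤ Q
    0≤Q = 0≤i^n k (+≤+ ℕ.z≤n)
    0≤4PQ : 0ℤ ≤ + 4 * P * Q
    0≤4PQ = 0≤i*j (0≤i*j {+ 4} (+≤+ ℕ.z≤n) 0≤P) 0≤Q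
    0≤PQQKⁿ : 0ℤ ≤ P * Q * Q * K ^ suc m
    0≤PQQKⁿ = 0≤i*j (0≤i*j (0≤i*j 0≤P 0≤Q) 0≤Q) (0≤i^n (suc m) (+≤+ ℕ.z≤n))

module NatInequalities where

  open import Data.Nat
  open import Data.Nat.Properties
  open import Relation.Binary.PropositionalEquality
  open import Relation.Nullary using (yes; no; contradiction)
  open import Data.Nat.Solver using (module +-*-Solver)
  open +-*-Solver

  *-^-distrib : (m n q : ℕ) → (m * n) ^ q ≡ m ^ q * n ^ q
  *-^-distrib m n zero    = refl
  *-^-distrib m n (suc q) = trans (cong (m * n *_) (*-^-distrib m n q))
    (solve 4 (λ m n a b → m :* n :* (a :* b) := m :* a :* (n :* b)) refl m n (m ^ q) (n ^ q))

  2^p*a^q<b^q : (p q a b : ℕ) → p < q → 1 ≤ a → 2 * a ≤ b → 2 ^ p * a ^ q < b ^ q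
  2^p*a^q<b^q p q a@(suc _) b p<q _ 2a≤b = begin-strict
    2 ^ p * a ^ q    <⟨ *-monoˡ-< (a ^ q) {{m^n≢0 a q}} (^-monoʳ-< 2 (s≤s (s≤s z≤n)) p<q) ⟩
    2 ^ q * a ^ q    ≡⟨ *-^-distrib 2 a q ⟨
    (2 * a) ^ q      ≤⟨ ^-monoˡ-≤ q 2a≤b ⟩
    b ^ q            ∎
    where open ≤-Reasoning

  k*x*x<y*y : (k x y : ℕ) → 1 ≤ k → 1 ≤ x → 4 * k * x ≤ y → k * x * x < y * y
  k*x*x<y*y k x y 1≤k 1≤x 4kx≤y = begin-strict
    k * x * x            <⟨ m<m*n (k * x * x) 4 {{>-nonZero (*-mono-≤ (*-mono-≤ 1≤k 1≤x) 1≤x)}} (s≤s (s≤s z≤n)) ⟩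
    k * x * x * 4        ≡⟨ solve 2 (λ k x → k :* x :* x :* con 4 := con 4 :* k :* x :* x) refl k x ⟩
    4 * k * x * x        ≤⟨ *-mono-≤ 4kx≤y x≤y ⟩
    y * y                ∎
    where
    open ≤-Reasoning
    x≤y : x ≤ y
    x≤y = ≤-trans (m≤n*m x (4 * k) {{>-nonZero (≤-trans (s≤s z≤n) (*-monoʳ-≤ 4 1≤k))}}) 4kx≤y

  2*e*g≤d*f : (k e g d f : ℕ) → 1 ≤ k → g ≤ f → 4 * k * (e * e) * g ≤ d * d * f → 2 * (e * g) ≤ d * f
  2*e*g≤d*f k e g d f 1≤k g≤f small with 2 * (e * g) ≤? d * f
  ... | yes 2eg≤df = 2eg≤df
  ... | no  2eg≰df = contradiction squares (<⇒≱ (*-mono-< (≰⇒> 2eg≰df) (≰⇒> 2eg≰df)))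
    where
    open ≤-Reasoning
    squares : 2 * (e * g) * (2 * (e * g)) ≤ d * f * (d * f)
    squares = begin
      2 * (e * g) * (2 * (e * g))
        ≡⟨ solve 2 (λ e g → con 2 :* (e :* g) :* (con 2 :* (e :* g)) := con 4 :* (e :* e) :* g :* g) refl e g ⟩
      4 * (e * e) * g * g
        ≤⟨ *-monoˡ-≤ g (*-monoˡ-≤ g (*-monoˡ-≤ (e * e) (*-monoʳ-≤ 4 1≤k))) ⟩
      4 * k * (e * e) * g * g
        ≤⟨ *-mono-≤ small g≤f ⟩
      d * d * f * f
        ≡⟨ solve 2 (λ d f → d :* d :* f :* f := d :* f :* (d :* f)) refl d f ⟩
      d * f * (d * f) ∎

  k*e⁴*g²<d⁴*f² : (k e g d f : ℕ) → 1 ≤ k → 1 ≤ e → 1 ≤ g → 4 * k * (e * e) * g ≤ d * d * f →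
                  k * e ^ 4 * g ^ 2 < d ^ 4 * f ^ 2
  k*e⁴*g²<d⁴*f² k e g d f 1≤k 1≤e 1≤g small = subst₂ _<_
    (solve 3 (λ k e g → k :* (e :* e :* g) :* (e :* e :* g) := k :* (e :^ 4) :* (g :^ 2)) refl k e g)
    (solve 2 (λ d f → d :* d :* f :* (d :* d :* f) := (d :^ 4) :* (f :^ 2)) refl d f)
    (k*x*x<y*y k (e * e * g) (d * d * f) 1≤k (*-mono-≤ (*-mono-≤ 1≤e 1≤e) 1≤g)
      (≤-trans (≤-reflexive (solve 3 (λ k e g → con 4 :* k :* (e :* e :* g) := con 4 :* k :* (e :* e) :* g) refl k e g)) small))

module RationalBridges where

  open import Data.Nat as ℕ using (ℕ; zero; suc)
  open import Data.Integer as ℤ using (ℤ; +_; 0ℤ; _+_; _*_; -_; _-_; _^_; _≤_; _<_; ∣_∣)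
  import Data.Integer.Properties as ℤP
  open import Data.Rational as ℚ using (ℚ; 0ℚ; ↥_; ↧_; toℚᵘ)
  import Data.Rational.Properties as ℚP
  open import Data.Rational.Unnormalised as ℚᵘ using (ℚᵘ; mkℚᵘ; *≤*; *<*)
  import Data.Rational.Unnormalised.Properties as ℚᵘP
  open import Relation.Binary.PropositionalEquality

  ε≤∣c/A-t/B∣⇒ : (c t A B : ℕ) → 0 ℕ.< A → 0 ℕ.< B → (ε : ℚ) → ε ℚ.≤ ℚ.∣ c /ₙ A ℚ.- t /ₙ B ∣ →
                 ↥ ε * (+ A * + B) ≤ + ∣ + c * + B - + t * + A ∣ * ↧ ε
  ε≤∣c/A-t/B∣⇒ c t (suc A) (suc B) _ _ ε@record{} ε≤ with ℚᵘP.≤-respʳ-≃ unnormalised (ℚP.toℚᵘ-mono-≤ ε≤)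
    where
    unnormalised : toℚᵘ ℚ.∣ c /ₙ suc A ℚ.- t /ₙ suc B ∣ ℚᵘ.≃ ℚᵘ.∣ mkℚᵘ (+ c) A ℚᵘ.- mkℚᵘ (+ t) B ∣
    unnormalised = ℚᵘP.≃-trans (ℚP.toℚᵘ-homo-∣-∣ (c/A ℚ.- t/B))
      (ℚᵘP.∣-∣-cong (ℚᵘP.≃-trans (ℚP.toℚᵘ-homo-+ c/A (ℚ.- t/B))
        (ℚᵘP.+-cong (ℚP.toℚᵘ-fromℚᵘ (mkℚᵘ (+ c) A))
                    (ℚᵘP.≃-trans (ℚP.toℚᵘ-homo‿- t/B) (ℚᵘP.-‿cong (ℚP.toℚᵘ-fromℚᵘ (mkℚᵘ (+ t) B)))))))
      where
      c/A t/B : ℚ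
      c/A = c /ₙ suc A
      t/B = t /ₙ suc B
  ... | *≤* cross = subst₂ _≤_ (cong (↥ ε *_) (ℤP.pos-* (suc A) (suc B)))
    (cong (λ s → + ∣ + c * + suc B + s ∣ * ↧ ε) (sym (ℤP.neg-distribˡ-* (+ t) (+ suc A)))) cross

  b*↧η<↥η*N⇒b/N<η : (b N : ℕ) (η : ℚ) → 0 ℕ.< N → + b * ↧ η < ↥ η * + N → b /ₙ N ℚ.< η
  b*↧η<↥η*N⇒b/N<η b (suc N) η@record{} _ cross =
    ℚP.toℚᵘ-cancel-< (ℚᵘP.<-respˡ-≃ (ℚᵘP.≃-sym (ℚP.toℚᵘ-fromℚᵘ (mkℚᵘ (+ b) N))) (*<* cross))

  _^ᵘ_ : ℚᵘ → ℕ → ℚᵘ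
  x ^ᵘ zero  = ℚᵘ.1ℚᵘ
  x ^ᵘ suc j = x ℚᵘ.* (x ^ᵘ j)

  toℚᵘ-^ℚ : (x : ℚ) (j : ℕ) → toℚᵘ (x ^ℚ j) ℚᵘ.≃ toℚᵘ x ^ᵘ j
  toℚᵘ-^ℚ x zero    = ℚᵘP.≃-refl
  toℚᵘ-^ℚ x (suc j) = ℚᵘP.≃-trans (ℚP.toℚᵘ-homo-* x (x ^ℚ j)) (ℚᵘP.*-congˡ {toℚᵘ x} (toℚᵘ-^ℚ x j))

  ↥ᵘ-* : (x y : ℚᵘ) → ℚᵘ.↥ (x ℚᵘ.* y) ≡ ℚᵘ.↥ x * ℚᵘ.↥ y
  ↥ᵘ-* (mkℚᵘ _ _) (mkℚᵘ _ _) = refl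

  ↧ᵘ-* : (x y : ℚᵘ) → ℚᵘ.↧ (x ℚᵘ.* y) ≡ ℚᵘ.↧ x * ℚᵘ.↧ y
  ↧ᵘ-* (mkℚᵘ _ b) (mkℚᵘ _ d) = ℤP.pos-* (suc b) (suc d)

  ↥ᵘ-^ᵘ : (x : ℚᵘ) (j : ℕ) → ℚᵘ.↥ (x ^ᵘ j) ≡ ℚᵘ.↥ x ^ j
  ↥ᵘ-^ᵘ x zero    = refl
  ↥ᵘ-^ᵘ x (suc j) = trans (↥ᵘ-* x (x ^ᵘ j)) (cong (ℚᵘ.↥ x *_) (↥ᵘ-^ᵘ x j))

  ↧ᵘ-^ᵘ : (x : ℚᵘ) (j : ℕ) → ℚᵘ.↧ (x ^ᵘ j) ≡ ℚᵘ.↧ x ^ j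
  ↧ᵘ-^ᵘ x zero    = refl
  ↧ᵘ-^ᵘ x (suc j) = trans (↧ᵘ-* x (x ^ᵘ j)) (cong (ℚᵘ.↧ x *_) (↧ᵘ-^ᵘ x j))

  ^ᵘ-cong : {x y : ℚᵘ} (j : ℕ) → x ℚᵘ.≃ y → x ^ᵘ j ℚᵘ.≃ y ^ᵘ j
  ^ᵘ-cong zero    x≃y = ℚᵘP.≃-refl
  ^ᵘ-cong (suc j) x≃y = ℚᵘP.*-cong x≃y (^ᵘ-cong j x≃y)

  0<↥ : (p : ℚ) → 0ℚ ℚ.< p → 0ℤ ℤ.< ↥ p
  0<↥ p (ℚ.*<* 0*↧p<↥p*1) = subst₂ _<_ (ℤP.*-zeroˡ (↧ p)) (ℤP.*-identityʳ (↥ p)) 0*↧p<↥p*1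

module LogHypothesis where

  open import Data.Nat as ℕ using (ℕ; suc)
  import Data.Nat.Properties as ℕP
  open import Data.Integer as ℤ using (ℤ; +_; +0; -[1+_]; +[1+_]; 0ℤ; 1ℤ; +≤+)
  import Data.Integer.Properties as ℤP
  open import Data.Rational as ℚ using (ℚ; mkℚ; 0ℚ; 1ℚ; ↥_; ↧_; ↧ₙ_; toℚᵘ)
  import Data.Rational.Properties as ℚP
  open import Data.Rational.Unnormalised as ℚᵘ using (ℚᵘ; mkℚᵘ; *≡*; *≤*)
  import Data.Rational.Unnormalised.Properties as ℚᵘP
  open import Relation.Nullary using (¬_; contradiction)
  open import Relation.Binary.PropositionalEquality
  open IntegerLemmas using (pos-^)
  open NatInequalities
  open RationalBridges

  Log2InvLe-nonNeg : (u t : ℚ) → 0ℤ ℤ.≤ ↥ t → Log2InvLe u t →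
                     1ℚ ℚ.≤ ((+ 2 ℚ./ 1) ^ℚ ℤ.∣ ↥ t ∣) ℚ.* (u ^ℚ (↧ₙ t))
  Log2InvLe-nonNeg u (mkℚ (+ p) q _) _ 1≤2^p*u^q = 1≤2^p*u^q

  i*+[1+n]≡+m⇒0≤i : (i : ℤ) (n m : ℕ) → i ℤ.* +[1+ n ] ≡ + m → 0ℤ ℤ.≤ i
  i*+[1+n]≡+m⇒0≤i (+ _)    n m _  = +≤+ ℕ.z≤n
  i*+[1+n]≡+m⇒0≤i -[1+ _ ] n m ()

  module PositiveFractions (k e d′ g f′ : ℕ) (ε η : ℚ)
                           (ε≡ : toℚᵘ ε ≡ mkℚᵘ +[1+ e ] d′) (η≡ : toℚᵘ η ≡ mkℚᵘ +[1+ g ] f′) where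
    private
      e₁ d g₁ f : ℕ
      e₁ = suc e
      d  = suc d′
      g₁ = suc g
      f  = suc f′
      E H : ℚᵘ
      E = mkℚᵘ (+ e₁) d′
      H = mkℚᵘ (+ g₁) f′
      t u : ℚ
      t = (+ suc k ℚ./ 1) ℚ.* (ε ^ℚ 4) ℚ.* (η ^ℚ 2)
      u = ε ℚ.* η

    ↥t*d⁴f²≡ke⁴g²*↧t : ↥ t ℤ.* + (d ℕ.^ 4 ℕ.* f ℕ.^ 2) ≡ + (suc k ℕ.* e₁ ℕ.^ 4 ℕ.* g₁ ℕ.^ 2) ℤ.* ↧ t
    ↥t*d⁴f²≡ke⁴g²*↧t with t≃Z
      where
      Z : ℚᵘ
      Z = mkℚᵘ (+ suc k) 0 ℚᵘ.* (E ^ᵘ 4) ℚᵘ.* (H ^ᵘ 2)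
      t≃Z : toℚᵘ t ℚᵘ.≃ Z
      t≃Z = ℚᵘP.≃-trans (ℚP.toℚᵘ-homo-* ((+ suc k ℚ./ 1) ℚ.* (ε ^ℚ 4)) (η ^ℚ 2))
        (ℚᵘP.*-cong (ℚᵘP.≃-trans (ℚP.toℚᵘ-homo-* (+ suc k ℚ./ 1) (ε ^ℚ 4))
                        (ℚᵘP.*-cong (ℚP.toℚᵘ-fromℚᵘ (mkℚᵘ (+ suc k) 0))
                                    (ℚᵘP.≃-trans (toℚᵘ-^ℚ ε 4) (^ᵘ-cong 4 (ℚᵘP.≃-reflexive ε≡)))))
                    (ℚᵘP.≃-trans (toℚᵘ-^ℚ η 2) (^ᵘ-cong 2 (ℚᵘP.≃-reflexive η≡))))
    ... | *≡* cross = trans (cong₂ ℤ._*_ (sym (ℚP.↥ᵘ-toℚᵘ t)) (sym ↧Z≡Zd))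
                            (trans cross (cong (+ (suc k ℕ.* e₁ ℕ.^ 4 ℕ.* g₁ ℕ.^ 2) ℤ.*_) (ℚP.↧ᵘ-toℚᵘ t)))
      where
      ↧Z≡Zd : ℚᵘ.↧ (mkℚᵘ (+ suc k) 0 ℚᵘ.* (E ^ᵘ 4) ℚᵘ.* (H ^ᵘ 2)) ≡ + (d ℕ.^ 4 ℕ.* f ℕ.^ 2)
      ↧Z≡Zd = begin
        ℚᵘ.↧ (mkℚᵘ (+ suc k) 0 ℚᵘ.* (E ^ᵘ 4) ℚᵘ.* (H ^ᵘ 2))
          ≡⟨ ↧ᵘ-* (mkℚᵘ (+ suc k) 0 ℚᵘ.* (E ^ᵘ 4)) (H ^ᵘ 2) ⟩
        ℚᵘ.↧ (mkℚᵘ (+ suc k) 0 ℚᵘ.* (E ^ᵘ 4)) ℤ.* ℚᵘ.↧ (H ^ᵘ 2)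
          ≡⟨ cong (ℤ._* ℚᵘ.↧ (H ^ᵘ 2))
                  (trans (↧ᵘ-* (mkℚᵘ (+ suc k) 0) (E ^ᵘ 4)) (ℤP.*-identityˡ (ℚᵘ.↧ (E ^ᵘ 4)))) ⟩
        ℚᵘ.↧ (E ^ᵘ 4) ℤ.* ℚᵘ.↧ (H ^ᵘ 2)
          ≡⟨ cong₂ ℤ._*_ (trans (↧ᵘ-^ᵘ E 4) (sym (pos-^ d 4))) (trans (↧ᵘ-^ᵘ H 2) (sym (pos-^ f 2))) ⟩
        + (d ℕ.^ 4) ℤ.* + (f ℕ.^ 2)
          ≡⟨ ℤP.pos-* (d ℕ.^ 4) (f ℕ.^ 2) ⟨
        + (d ℕ.^ 4 ℕ.* f ℕ.^ 2) ∎
        where open ≡-Reasoning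

    1≤2^p*u^q⇒ : (p q : ℕ) → 1ℚ ℚ.≤ ((+ 2 ℚ./ 1) ^ℚ p) ℚ.* (u ^ℚ q) →
                 (d ℕ.* f) ℕ.^ q ℕ.≤ 2 ℕ.^ p ℕ.* (e₁ ℕ.* g₁) ℕ.^ q
    1≤2^p*u^q⇒ p q 1≤ with ℚᵘP.≤-respʳ-≃ R≃ (ℚP.toℚᵘ-mono-≤ 1≤)
      where
      R≃ : toℚᵘ (((+ 2 ℚ./ 1) ^ℚ p) ℚ.* (u ^ℚ q)) ℚᵘ.≃ (mkℚᵘ (+ 2) 0 ^ᵘ p) ℚᵘ.* ((E ℚᵘ.* H) ^ᵘ q)
      R≃ = ℚᵘP.≃-trans (ℚP.toℚᵘ-homo-* ((+ 2 ℚ./ 1) ^ℚ p) (u ^ℚ q))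
        (ℚᵘP.*-cong (toℚᵘ-^ℚ (+ 2 ℚ./ 1) p)
          (ℚᵘP.≃-trans (toℚᵘ-^ℚ u q) (^ᵘ-cong q (ℚᵘP.≃-trans (ℚP.toℚᵘ-homo-* ε η)
                                                              (ℚᵘP.*-cong (ℚᵘP.≃-reflexive ε≡) (ℚᵘP.≃-reflexive η≡))))))
    ... | *≤* cross = ℤP.drop‿+≤+ (subst₂ ℤ._≤_ lhs rhs cross)
      where
      open ≡-Reasoning
      lhs : 1ℤ ℤ.* ℚᵘ.↧ ((mkℚᵘ (+ 2) 0 ^ᵘ p) ℚᵘ.* ((E ℚᵘ.* H) ^ᵘ q)) ≡ + ((d ℕ.* f) ℕ.^ q)
      lhs = begin
        1ℤ ℤ.* ℚᵘ.↧ ((mkℚᵘ (+ 2) 0 ^ᵘ p) ℚᵘ.* ((E ℚᵘ.* H) ^ᵘ q))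
          ≡⟨ trans (ℤP.*-identityˡ _) (↧ᵘ-* (mkℚᵘ (+ 2) 0 ^ᵘ p) ((E ℚᵘ.* H) ^ᵘ q)) ⟩
        ℚᵘ.↧ (mkℚᵘ (+ 2) 0 ^ᵘ p) ℤ.* ℚᵘ.↧ ((E ℚᵘ.* H) ^ᵘ q)
          ≡⟨ cong₂ ℤ._*_ (trans (↧ᵘ-^ᵘ (mkℚᵘ (+ 2) 0) p) (ℤP.^-zeroˡ p)) (↧ᵘ-^ᵘ (E ℚᵘ.* H) q) ⟩
        1ℤ ℤ.* ℚᵘ.↧ (E ℚᵘ.* H) ℤ.^ q
          ≡⟨ trans (ℤP.*-identityˡ _) (cong (ℤ._^ q) (trans (↧ᵘ-* E H) (sym (ℤP.pos-* d f)))) ⟩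
        (+ (d ℕ.* f)) ℤ.^ q
          ≡⟨ pos-^ (d ℕ.* f) q ⟨
        + ((d ℕ.* f) ℕ.^ q) ∎
      rhs : ℚᵘ.↥ ((mkℚᵘ (+ 2) 0 ^ᵘ p) ℚᵘ.* ((E ℚᵘ.* H) ^ᵘ q)) ℤ.* 1ℤ ≡ + (2 ℕ.^ p ℕ.* (e₁ ℕ.* g₁) ℕ.^ q)
      rhs = begin
        ℚᵘ.↥ ((mkℚᵘ (+ 2) 0 ^ᵘ p) ℚᵘ.* ((E ℚᵘ.* H) ^ᵘ q)) ℤ.* 1ℤ
          ≡⟨ trans (ℤP.*-identityʳ _) (↥ᵘ-* (mkℚᵘ (+ 2) 0 ^ᵘ p) ((E ℚᵘ.* H) ^ᵘ q)) ⟩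
        ℚᵘ.↥ (mkℚᵘ (+ 2) 0 ^ᵘ p) ℤ.* ℚᵘ.↥ ((E ℚᵘ.* H) ^ᵘ q)
          ≡⟨ cong₂ ℤ._*_ (trans (↥ᵘ-^ᵘ (mkℚᵘ (+ 2) 0) p) (sym (pos-^ 2 p)))
                         (trans (↥ᵘ-^ᵘ (E ℚᵘ.* H) q) (sym (pos-^ (e₁ ℕ.* g₁) q))) ⟩
        + (2 ℕ.^ p) ℤ.* + ((e₁ ℕ.* g₁) ℕ.^ q)
          ≡⟨ ℤP.pos-* (2 ℕ.^ p) ((e₁ ℕ.* g₁) ℕ.^ q) ⟨
        + (2 ℕ.^ p ℕ.* (e₁ ℕ.* g₁) ℕ.^ q) ∎

    Log2InvLe-fails : g₁ ℕ.≤ f → 4 ℕ.* suc k ℕ.* (e₁ ℕ.* e₁) ℕ.* g₁ ℕ.≤ d ℕ.* d ℕ.* f → ¬ Log2InvLe u t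
    Log2InvLe-fails g≤f small hyp =
      ℕP.<⇒≱ (2^p*a^q<b^q p q (e₁ ℕ.* g₁) (d ℕ.* f) p<q (ℕ.s≤s ℕ.z≤n)
                          (2*e*g≤d*f (suc k) e₁ g₁ d f (ℕ.s≤s ℕ.z≤n) g≤f small))
             (1≤2^p*u^q⇒ p q (Log2InvLe-nonNeg u t 0≤↥t hyp))
      where
      Zn Zd p q : ℕ
      Zn = suc k ℕ.* e₁ ℕ.^ 4 ℕ.* g₁ ℕ.^ 2
      Zd = d ℕ.^ 4 ℕ.* f ℕ.^ 2
      p  = ℤ.∣ ↥ t ∣
      q  = ↧ₙ t
      cross : ↥ t ℤ.* + Zd ≡ + (Zn ℕ.* q)
      cross = trans ↥t*d⁴f²≡ke⁴g²*↧t (sym (ℤP.pos-* Zn q))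
      0≤↥t : 0ℤ ℤ.≤ ↥ t
      0≤↥t = i*+[1+n]≡+m⇒0≤i (↥ t) _ _ cross
      p*Zd≡Zn*q : p ℕ.* Zd ≡ Zn ℕ.* q
      p*Zd≡Zn*q = ℤP.+-injective (trans (ℤP.pos-* p Zd) (trans (cong (ℤ._* + Zd) (ℤP.0≤i⇒+∣i∣≡i 0≤↥t)) cross))
      p<q : p ℕ.< q
      p<q = ℕP.*-cancelʳ-< Zd p q (begin-strict
        p ℕ.* Zd   ≡⟨ p*Zd≡Zn*q ⟩
        Zn ℕ.* q   <⟨ ℕP.*-monoˡ-< q {{ℕ.>-nonZero (ℕ.s≤s ℕ.z≤n)}}
                         (k*e⁴*g²<d⁴*f² (suc k) e₁ g₁ d f (ℕ.s≤s ℕ.z≤n) (ℕ.s≤s ℕ.z≤n) (ℕ.s≤s ℕ.z≤n) small) ⟩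
        Zd ℕ.* q   ≡⟨ ℕP.*-comm Zd q ⟩
        q ℕ.* Zd   ∎)
        where open ℕP.≤-Reasoning

  log-hypothesis-fails : (k : ℕ) (ε η : ℚ) → 0ℚ ℚ.< ε → 0ℚ ℚ.< η → ↥ η ℤ.≤ ↧ η →
    + 4 ℤ.* + suc k ℤ.* (↥ ε ℤ.* ↥ ε) ℤ.* ↥ η ℤ.≤ ↧ ε ℤ.* ↧ ε ℤ.* ↧ η →
    ¬ Log2InvLe (ε ℚ.* η) ((+ suc k ℚ./ 1) ℚ.* (ε ^ℚ 4) ℚ.* (η ^ℚ 2))
  log-hypothesis-fails k ε@(mkℚ +[1+ e ] d′ _) η@(mkℚ +[1+ g ] f′ _) _ _ (+≤+ g≤f) small =
    Log2InvLe-fails g≤f (ℤP.drop‿+≤+ small)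
    where open PositiveFractions k e d′ g f′ ε η refl refl
  log-hypothesis-fails k ε@(mkℚ +0       _ _) _ 0<ε = contradiction (0<↥ ε 0<ε) (ℤP.<-irrefl refl)
  log-hypothesis-fails k ε@(mkℚ -[1+ _ ] _ _) _ 0<ε = contradiction (0<↥ ε 0<ε) λ ()
  log-hypothesis-fails k (mkℚ +[1+ _ ] _ _) η@(mkℚ +0       _ _) _ 0<η = contradiction (0<↥ η 0<η) (ℤP.<-irrefl refl)
  log-hypothesis-fails k (mkℚ +[1+ _ ] _ _) η@(mkℚ -[1+ _ ] _ _) _ 0<η = contradiction (0<↥ η 0<η) λ ()

module Chebyshev where

  open import Data.Bool using (Bool)
  open import Data.Nat as ℕ using (ℕ; suc)
  import Data.Nat.Properties as ℕP
  open import Data.Integer as ℤ using (ℤ; +_; 0ℤ; 1ℤ; _+_; _*_; -_; _-_; _^_; _≤_; _<_; +≤+; ∣_∣)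
  import Data.Integer.Properties as ℤP
  open import Data.Rational as ℚ using (ℚ; 0ℚ; ↥_; ↧_)
  open import Data.Fin using (Fin)
  open import Data.List using (List; length; filter)
  open import Data.Vec using (Vec)
  open import Data.Product using (_×_; _,_; proj₁; proj₂)
  open import Relation.Unary using (Decidable)
  open import Relation.Binary.PropositionalEquality
  open import Data.Integer.Solver using (module +-*-Solver)
  open +-*-Solver
  open Sums
  open IntegerLemmas
  open BooleanCube using (cube)
  open SecondMoment
  open RationalBridges

  deviates? : (n k : ℕ) (T : Cube n → Bool) (ε : ℚ) →
              Decidable (λ (p : Cube n × Vec (Fin k) n) →
                           ε ℚ.≤ ℚ.∣ (cardInCube T (proj₁ p) (proj₂ p) /ₙ (2 ℕ.^ k)) ℚ.- density T ∣)
  deviates? n k T ε p = ε ℚ.≤? ℚ.∣ (cardInCube T (proj₁ p) (proj₂ p) /ₙ (2 ℕ.^ k)) ℚ.- density T ∣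

  deviants : (n k : ℕ) → (Cube n → Bool) → ℚ → List (Cube n × Vec (Fin k) n)
  deviants n k T ε = filter (deviates? n k T ε) (samples n k)

  module _ (m k : ℕ) (T : Cube (suc m) → Bool) where
    open Sampling (suc m) k T

    +N≡P*Kⁿ : + (2 ℕ.^ suc m ℕ.* k ℕ.^ suc m) ≡ P * K ^ suc m
    +N≡P*Kⁿ = trans (ℤP.pos-* (2 ℕ.^ suc m) (k ℕ.^ suc m)) (cong₂ _*_ (pos-^ 2 (suc m)) (pos-^ k (suc m)))

    length-samples : length (samples (suc m) k) ≡ 2 ℕ.^ suc m ℕ.* k ℕ.^ suc m
    length-samples = ℤP.+-injective (trans +length≡ (sym +N≡P*Kⁿ))
      where
      +length≡ : + length (samples (suc m) k) ≡ P * K ^ suc m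
      +length≡ = begin
        + length (samples (suc m) k)              ≡⟨ ℤP.*-identityʳ _ ⟨
        + length (samples (suc m) k) * 1ℤ         ≡⟨ ∑-const (samples (suc m) k) 1ℤ ⟨
        ∑[ _ ∈ samples (suc m) k ] 1ℤ             ≡⟨ ∑-samples (λ _ → 1ℤ) ⟩
        ∑ₛ (λ _ _ → 1ℤ)                           ≡⟨ ∑ₛ-const 1ℤ ⟩
        P * K ^ suc m * 1ℤ                        ≡⟨ ℤP.*-identityʳ _ ⟩
        P * K ^ suc m ∎
        where open ≡-Reasoning

    ε≤deviation⇒ : (ε : ℚ) (a : Cube (suc m)) (h : Vec (Fin k) (suc m)) →
      ε ℚ.≤ ℚ.∣ (cardInCube T a h /ₙ (2 ℕ.^ k)) ℚ.- density T ∣ → ↥ ε * (Q * P) ≤ + ∣ deviation a h ∣ * ↧ ε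
    ε≤deviation⇒ ε a h ε≤ = subst₂ _≤_
      (cong (↥ ε *_) (cong₂ _*_ (pos-^ 2 k) (pos-^ 2 (suc m))))
      (cong (λ s → + ∣ s ∣ * ↧ ε) (begin
        + cardInCube T a h * + (2 ℕ.^ suc m) - + card T * + (2 ℕ.^ k)
          ≡⟨ cong₂ (λ c t → c * + (2 ℕ.^ suc m) - t * + (2 ℕ.^ k)) (cardInCube≡hits a h) card≡τ ⟩
        hits a h * + (2 ℕ.^ suc m) - τ * + (2 ℕ.^ k)
          ≡⟨ cong₂ (λ p q → hits a h * p - τ * q) (pos-^ 2 (suc m)) (pos-^ 2 k) ⟩
        hits a h * P - τ * Q
          ≡⟨ cong₂ _-_ (ℤP.*-comm (hits a h) P) (ℤP.*-comm τ Q) ⟩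
        deviation a h ∎))
      (ε≤∣c/A-t/B∣⇒ (cardInCube T a h) (card T) (2 ℕ.^ k) (2 ℕ.^ suc m) (ℕP.m^n>0 2 k) (ℕP.m^n>0 2 (suc m)) ε ε≤)
      where open ≡-Reasoning

    #deviants*ε²≤ : (ε : ℚ) → 0ℚ ℚ.< ε →
      + length (deviants (suc m) k T ε) * (↥ ε * (Q * P) * (↥ ε * (Q * P)))
        ≤ ↧ ε * ↧ ε * ∑ₛ (λ a h → deviation a h * deviation a h)
    #deviants*ε²≤ ε 0<ε = begin
      + length (deviants (suc m) k T ε) * (↥ ε * (Q * P) * (↥ ε * (Q * P)))
        ≤⟨ length-filter*c≤∑ (deviates? (suc m) k T ε) (samples (suc m) k) (λ p → scaled p * scaled p) _
             (λ p → 0≤i*i (scaled p)) (λ (a , h) ε≤ → *-self-mono-≤ 0≤ε*QP (ε≤deviation⇒ ε a h ε≤)) ⟩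
      ∑[ p ∈ samples (suc m) k ] (scaled p * scaled p)
        ≡⟨ ∑-samples (λ p → scaled p * scaled p) ⟩
      ∑ₛ (λ a h → scaled (a , h) * scaled (a , h))
        ≡⟨ ∑-cong (cube (suc m)) (λ a → ∑-cong hashes (λ h → squared (deviation a h))) ⟩
      ∑ₛ (λ a h → ↧ ε * ↧ ε * (deviation a h * deviation a h))
        ≡⟨ ∑ₛ-*ˡ (↧ ε * ↧ ε) _ ⟩
      ↧ ε * ↧ ε * ∑ₛ (λ a h → deviation a h * deviation a h) ∎
      where
      open ℤP.≤-Reasoning
      scaled : Cube (suc m) × Vec (Fin k) (suc m) → ℤ
      scaled (a , h) = + ∣ deviation a h ∣ * ↧ ε
      0≤ε*QP : 0ℤ ≤ ↥ ε * (Q * P)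
      0≤ε*QP = 0≤i*j (ℤP.<⇒≤ (0<↥ ε 0<ε)) (ℤP.<⇒≤ (0<i*j (0<2^n k) (0<2^n (suc m))))
      squared : (D : ℤ) → + ∣ D ∣ * ↧ ε * (+ ∣ D ∣ * ↧ ε) ≡ ↧ ε * ↧ ε * (D * D)
      squared D = trans (solve 2 (λ x d → x :* d :* (x :* d) := d :* d :* (x :* x)) refl (+ ∣ D ∣) (↧ ε))
                        (cong (↧ ε * ↧ ε *_) (+∣i∣*+∣i∣≡i*i D))

    4k*ε²*#deviants≤ : (ε : ℚ) → 0ℚ ℚ.< ε →
      + 4 * K * (↥ ε * ↥ ε) * + length (deviants (suc m) k T ε) ≤ ↧ ε * ↧ ε * + (2 ℕ.^ suc m ℕ.* k ℕ.^ suc m)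
    4k*ε²*#deviants≤ ε 0<ε = subst (λ N → + 4 * K * (↥ ε * ↥ ε) * B ≤ ↧ ε * ↧ ε * N) (sym +N≡P*Kⁿ)
      (ℤP.*-cancelʳ-≤-pos _ _ (QP * QP) {{ℤ.positive (0<i*j 0<QP 0<QP)}} (begin
        + 4 * K * (↥ ε * ↥ ε) * B * (QP * QP)
          ≡⟨ solve 4 (λ K B e x → con (+ 4) :* K :* (e :* e) :* B :* (x :* x) := con (+ 4) :* K :* (B :* (e :* x :* (e :* x))))
                   refl K B (↥ ε) QP ⟩
        + 4 * K * (B * (↥ ε * QP * (↥ ε * QP)))
          ≤⟨ ℤP.*-monoˡ-≤-nonNeg (+ 4 * K) {{ℤ.nonNegative (0≤i*j {+ 4} {K} (+≤+ ℕ.z≤n) (+≤+ ℕ.z≤n))}}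
                                 (#deviants*ε²≤ ε 0<ε) ⟩
        + 4 * K * (↧ ε * ↧ ε * S)
          ≡⟨ solve 3 (λ K d S → con (+ 4) :* K :* (d :* d :* S) := d :* d :* (con (+ 4) :* K :* S)) refl K (↧ ε) S ⟩
        ↧ ε * ↧ ε * (+ 4 * K * S)
          ≤⟨ ℤP.*-monoˡ-≤-nonNeg (↧ ε * ↧ ε) {{ℤ.nonNegative (0≤i*i (↧ ε))}} (4k*∑ₛ-deviation²≤ m k T) ⟩
        ↧ ε * ↧ ε * (P * K ^ suc m * ((P * Q) * (P * Q)))
          ≡⟨ solve 4 (λ d N P Q → d :* d :* (N :* ((P :* Q) :* (P :* Q))) := d :* d :* N :* ((Q :* P) :* (Q :* P)))
                   refl (↧ ε) (P * K ^ suc m) P Q ⟩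
        ↧ ε * ↧ ε * (P * K ^ suc m) * (QP * QP) ∎))
      where
      open ℤP.≤-Reasoning
      B QP S : ℤ
      B  = + length (deviants (suc m) k T ε)
      QP = Q * P
      S  = ∑ₛ (λ a h → deviation a h * deviation a h)
      0<QP : 0ℤ < QP
      0<QP = 0<i*j (0<2^n k) (0<2^n (suc m))

open import Data.Bool using (Bool)
open import Data.Nat as ℕ using (ℕ; zero; suc; _≤_)
import Data.Nat.Properties as ℕP
open import Data.Integer as ℤ using (+_)
import Data.Integer.Properties as ℤP
open import Data.Rational as ℚ using (ℚ; _/_; 0ℚ; _*_; _<_)
import Data.Rational.Properties as ℚP
open import Data.List using ([]; length)
import Data.List.Properties as List
open import Data.List.Relation.Unary.All using (_∷_; [])
open import Data.Vec using ([])
open import Data.Product using (Σ; _,_)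
open import Relation.Nullary using (¬_; Dec; yes; no; contradiction)
open import Relation.Binary.PropositionalEquality
open IntegerLemmas using (0≤i*i; 0≤i*j; b*f<g*N⇐b≤N; b*f<g*N⇐c*b≤x*N)
open SecondMoment using (module Sampling)
open RationalBridges using (b*↧η<↥η*N⇒b/N<η)
open LogHypothesis using (log-hypothesis-fails)
open Chebyshev

prDeviates-0-0 : (T : Cube 0 → Bool) (ε η : ℚ) → 0ℚ < ε → 0ℚ < η → prDeviates 0 0 T ε < η
prDeviates-0-0 T ε η 0<ε 0<η = subst (λ b → b /ₙ 1 < η) (cong length (sym no-deviants)) 0<η
  where
  open Sampling 0 0 T using (cardInCube≡hits; card≡τ)
  cardInCube≡card : cardInCube {0} {0} T [] [] ≡ card T
  cardInCube≡card = ℤP.+-injective (trans (cardInCube≡hits [] []) (sym card≡τ))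
  no-deviation : ¬ (ε ℚ.≤ ℚ.∣ cardInCube {0} {0} T [] [] /ₙ 1 ℚ.- card T /ₙ 1 ∣)
  no-deviation ε≤ = ℚP.<-irrefl refl (ℚP.<-≤-trans 0<ε (subst (ε ℚ.≤_) ∣c-c∣≡0 ε≤))
    where
    ∣c-c∣≡0 : ℚ.∣ cardInCube {0} {0} T [] [] /ₙ 1 ℚ.- card T /ₙ 1 ∣ ≡ 0ℚ
    ∣c-c∣≡0 = trans (cong (λ c → ℚ.∣ c /ₙ 1 ℚ.- card T /ₙ 1 ∣) cardInCube≡card)
                    (cong ℚ.∣_∣ (ℚP.+-inverseʳ (card T /ₙ 1)))
  no-deviants : deviants 0 0 T ε ≡ []
  no-deviants = List.filter-none (deviates? 0 0 T ε) (no-deviation ∷ [])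

-- There are no maps [n] → [0] for n ≥ 1: the sample space is empty and prDeviates is 0 by the
-- convention x /ₙ 0 = 0.
prDeviates-suc-0 : (m : ℕ) (T : Cube (suc m) → Bool) (ε η : ℚ) → 0ℚ < η → prDeviates (suc m) 0 T ε < η
prDeviates-suc-0 m T ε η 0<η = subst (λ N → length (deviants (suc m) 0 T ε) /ₙ N < η) (sym (ℕP.*-zeroʳ (2 ℕ.^ suc m))) 0<η

prDeviates-suc-suc : (m k : ℕ) (T : Cube (suc m) → Bool) (ε η : ℚ) → 0ℚ < ε → 0ℚ < η →
  Log2InvLe (ε * η) (((+ suc k) / 1) * (ε ^ℚ 4) * (η ^ℚ 2)) → prDeviates (suc m) (suc k) T ε < η
prDeviates-suc-suc m k T ε η 0<ε 0<η hyp =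
  b*↧η<↥η*N⇒b/N<η b N η 0<N (by-cases (ℚ.↥ η ℤ.≤? ℚ.↧ η) (c ℤ.* ℚ.↥ η ℤ.≤? x ℤ.* ℚ.↧ η))
  where
  b N : ℕ
  b = length (deviants (suc m) (suc k) T ε)
  N = 2 ℕ.^ suc m ℕ.* suc k ℕ.^ suc m
  0<N : 0 ℕ.< N
  0<N = ℕP.*-mono-≤ (ℕP.m^n>0 2 (suc m)) (ℕP.m^n>0 (suc k) (suc m))
  c x : ℤ.ℤ
  c = + 4 ℤ.* + suc k ℤ.* (ℚ.↥ ε ℤ.* ℚ.↥ ε)
  x = ℚ.↧ ε ℤ.* ℚ.↧ ε
  by-cases : Dec (ℚ.↥ η ℤ.≤ ℚ.↧ η) → Dec (c ℤ.* ℚ.↥ η ℤ.≤ x ℤ.* ℚ.↧ η) →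
             + b ℤ.* ℚ.↧ η ℤ.< ℚ.↥ η ℤ.* + N
  by-cases (no η≰1) _ = b*f<g*N⇐b≤N (ℤ.+≤+ ℕ.z≤n) (ℤ.+<+ 0<N)
    (ℤ.+≤+ (subst (b ℕ.≤_) (length-samples m (suc k) T)
                          (List.length-filter (deviates? (suc m) (suc k) T ε) (samples (suc m) (suc k)))))
    (ℤP.≰⇒> η≰1)
  by-cases (yes η≤1) (yes small) = contradiction hyp (log-hypothesis-fails k ε η 0<ε 0<η η≤1 small)
  by-cases (yes _)   (no large)  = b*f<g*N⇐c*b≤x*N {c} {x} (0≤i*j {+ 4 ℤ.* + suc k} (ℤ.+≤+ ℕ.z≤n) (0≤i*i (ℚ.↥ ε)))
    (ℤ.+≤+ ℕ.z≤n) (ℤ.+<+ 0<N) (4k*ε²*#deviants≤ m (suc k) T ε 0<ε) (ℤP.≰⇒> large)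

lemma2p9 : Σ ℕ λ A′ → (n k : ℕ) → k ≤ n → (T : Cube n → Bool) → (ε η : ℚ) →
    0ℚ < ε → 0ℚ < η →
    Log2InvLe (ε * η) (((+ k) / suc A′) * (ε ^ℚ 4) * (η ^ℚ 2)) →
    prDeviates n k T ε < η
lemma2p9 = 0 , bound
  where
  bound : (n k : ℕ) → k ≤ n → (T : Cube n → Bool) → (ε η : ℚ) → 0ℚ < ε → 0ℚ < η →
          Log2InvLe (ε * η) (((+ k) / 1) * (ε ^ℚ 4) * (η ^ℚ 2)) → prDeviates n k T ε < η
  bound zero    zero    _ T ε η 0<ε 0<η _   = prDeviates-0-0 T ε η 0<ε 0<η
  bound (suc m) zero    _ T ε η _   0<η _   = prDeviates-suc-0 m T ε η 0<η
  bound (suc m) (suc k) _ T ε η 0<ε 0<η hyp = prDeviates-suc-suc m k T ε η 0<ε 0<η hyp
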